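{- Let $q=p^m$ be a power of a prime $p$, let $G\in\mathbb{F}_q[x]$, let $n,r$ be positive integers such that $d:=(m,r)=(mn,r)$, $p\nmid n$ and $(n,p^d-1)=1$, let $a\in\mathbb{F}_q^*$, and let \[f(x)=ax^{p^r}+x\left(G(T(x))-aT(x)^{p^r-1}\right).\] Assume $f$ is a permutation polynomial over $\mathbb{F}_{q^n}$. Then $\bar f(x):=xG(x)$ is a permutation polynomial over $\mathbb{F}_q$ and $\varphi_y(x):=ax^{p^r}+x(G(y)-ay^{p^r-1})$ induces a permutation of $\ker(T)$ for each $y\in\mathbb{F}_q$. Let $\bar f^{ -1}\in\mathbb{F}_q[x]$ denote the compositional inverse of $\bar f$ over $\mathbb{F}_q$ and define \[C(x):=\bar f^{ -1}(T(x))^{p^r-1}-a^{ -1}G\left(\bar f^{ -1}(T(x))\right).\] Then: (i) If $x\in\mathbb{F}_{q^n}$ satisfies $C(x)=0$, then the preimage of $x$ under $f$ is $f^{ -1}(x)=(x/a)^{q^n/p^r}$. (ii) Otherwise, if $x\in\mathbb{F}_{q^n}$ satisfies $N_{q|p^d}(C(x))\neq1$, then $N_{q|p^d}(C(x))^n\neq1$ and the preimage of $x$ under $f$ is \[f^{ -1}(x)=\frac{N_{q|p^d}(C(x))^n}{1-N_{q|p^d}(C(x))^n}\sum_{i=0}^{\frac{mn}{d}-1}C(x)^{ -\frac{p^{(i+1)r}-1}{p^r-1}}\left(a^{ -1}x\right)^{p^{ir}}.\] (iii) Otherwise (i.e. $C(x)\neq0$ and $N_{q|p^d}(C(x))=1$),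 the preimage of $x\in\mathbb{F}_{q^n}$ under $f$ is \[f^{ -1}(x)=n^{ -1}\left(\bar f^{ -1}(T(x))+\sum_{j=0}^{\frac{m}{d}-1}C(x)^{ -\frac{p^{(j+1)r}-1}{p^r-1}}\left(a^{ -1}\sum_{k=1}^{n-1}k\,x^{p^{kmr/d}}\right)^{p^{jr}}\right).\]
   Context: $T(x)=T_{q^n|q}(x)=\sum_{i=0}^{n-1}x^{q^i}$ is the trace from $\mathbb{F}_{q^n}$ to $\mathbb{F}_q$, $\ker(T)$ its kernel, and $N_{q|p^d}(x)=x^{(q-1)/(p^d-1)}$ the norm from $\mathbb{F}_q$ to $\mathbb{F}_{p^d}$. Integers $n,k$ are viewed in the prime field $\mathbb{F}_p$ and $n^{ -1}$ is the inverse there. -}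

module Defs where

open import Level using (0ℓ)
open import Algebra.Bundles using (CommutativeRing)
open import Data.Nat as ℕ using (ℕ; zero; suc; _∸_)
open import Data.Nat.GCD using (gcd)
open import Data.Fin using (Fin)
open import Data.List using (List; []; _∷_)
open import Data.Product using (Σ; ∃; _×_)
open import Data.Unit using (⊤)
open import Relation.Binary.PropositionalEquality using (_≡_)
open import Relation.Nullary using (¬_)

-- natural-number division, with the (never used) convention a / 0 = 0
divN : ℕ → ℕ → ℕ
divN a zero = 0
divN a (suc b) = a ℕ./ suc b

-- All finite-field notions relative to a commutative ring R (a field, via `inv`)
-- and the parameters p, m, n, r of the paper (q = p^m, F_{q^n} = Carrier).
module Setup (R : CommutativeRing 0ℓ 0ℓ)
             (inv : CommutativeRing.Carrier R → CommutativeRing.Carrier R)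
             (p m n r : ℕ) where
  open CommutativeRing R

  pow : Carrier → ℕ → Carrier
  pow x zero = 1#
  pow x (suc k) = x * pow x k

  _·_ : ℕ → Carrier → Carrier
  zero · x = 0#
  suc k · x = x + k · x

  Σ< : ℕ → (ℕ → Carrier) → Carrier
  Σ< zero g = 0#
  Σ< (suc k) g = Σ< k g + g k

  q : ℕ
  q = p ℕ.^ m

  d : ℕ
  d = gcd m r

  HasSize : ℕ → Set
  HasSize N = Σ (Fin N → Carrier) λ e →
    (∀ i j → e i ≈ e j → i ≡ j) × (∀ x → ∃ λ i → e i ≈ x)

  InFq : Carrier → Set
  InFq x = pow x q ≈ x

  -- polynomials as coefficient lists (constant term first), and evaluation
  Poly : Set
  Poly = List Carrier

  eval : Poly → Carrier → Carrier
  eval [] x = 0#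
  eval (c ∷ cs) x = c + x * eval cs x

  PermOn : (Carrier → Set) → (Carrier → Carrier) → Set
  PermOn P g = (∀ x → P x → P (g x))
             × (∀ x y → P x → P y → g x ≈ g y → x ≈ y)
             × (∀ y → P y → ∃ λ x → P x × g x ≈ y)

  T : Carrier → Carrier
  T x = Σ< n (λ i → pow x (q ℕ.^ i))

  Nrm : Carrier → Carrier
  Nrm y = pow y (divN (q ∸ 1) (p ℕ.^ d ∸ 1))

  module WithG (G : Poly) (a : Carrier) where

    f : Carrier → Carrier
    f x = a * pow x (p ℕ.^ r)
        + x * (eval G (T x) - a * pow (T x) (p ℕ.^ r ∸ 1))

    fbar : Carrier → Carrier
    fbar x = x * eval G x

    φ : Carrier → Carrier → Carrier
    φ y x = a * pow x (p ℕ.^ r) + x * (eval G y - a * pow y (p ℕ.^ r ∸ 1))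

    e : ℕ → ℕ
    e i = divN (p ℕ.^ (suc i ℕ.* r) ∸ 1) (p ℕ.^ r ∸ 1)

    module WithInv (finv : Poly) where

      C : Carrier → Carrier
      C x = pow (eval finv (T x)) (p ℕ.^ r ∸ 1)
          - inv a * eval G (eval finv (T x))

      -- (x/a)^{q^n/p^r}, i.e. the p^r-th root of x/a in F_{q^n},
      -- written as (x/a)^{p^{mnr - r}} (valid since y^{p^{mn}} = y)
      formula1 : Carrier → Carrier
      formula1 x = pow (x * inv a) (p ℕ.^ (m ℕ.* n ℕ.* r ∸ r))

      formula2 : Carrier → Carrier
      formula2 x =
        (pow (Nrm (C x)) n * inv (1# - pow (Nrm (C x)) n))
        * Σ< (divN (m ℕ.* n) d)
             (λ i → pow (inv (C x)) (e i) * pow (inv a * x) (p ℕ.^ (i ℕ.* r)))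

      S : Carrier → Carrier
      S x = Σ< (n ∸ 1) (λ j → suc j · pow x (p ℕ.^ divN (suc j ℕ.* m ℕ.* r) d))

      formula3 : Carrier → Carrier
      formula3 x =
        inv (n · 1#)
        * (eval finv (T x)
           + Σ< (divN m d)
                (λ j → pow (inv (C x)) (e j) * pow (inv a * S x) (p ℕ.^ (j ℕ.* r))))

{-# OPTIONS --safe #-}
module Submission where

-- Write σ_k(x) = x^(p^k). Since T ∘ f = fbar ∘ T and f(u/n) = fbar(u)/n for u ∈ F_q, the map fbar permutes F_q,
-- and on each fibre T⁻¹(y) the map f is φ_y up to translation by y/n. For z = fbar⁻¹(T x) the preimage w of x
-- lies in T⁻¹(z), on which f y = a (σ_r(y) − C y); so w is the unique y with T y = z and σ_r(y) = C y + x/a.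
-- If C = 0 this is a p^r-th root. Otherwise iterating the equation k times telescopes with the factor
-- C^((p^{kr}−1)/(p^r−1)), which over the period mn/d of σ_r on F_{q^n} equals N(C)^n, and over the period m/d on F_q
-- equals N(C); this solves for w when N(C)^n ≠ 1 (and gcd(n, p^d − 1) = 1 turns N(C) ≠ 1 into N(C)^n ≠ 1).
-- When N(C) = 1, the sum S x = Σ k x^(p^{kmr/d}) satisfies σ_{tr}(S x) + T x = S x + n x, which produces an
-- explicit solution of trace z.

open import Defs
open import Level using (0ℓ)
open import Algebra.Bundles using (CommutativeRing; CommutativeMonoid)
open import Data.Nat as ℕ using (ℕ; zero; suc; _≥_; _∸_; _<_; _≤_; s≤s; z≤n; NonZero; _!; nonTrivial⇒n>1)
import Data.Nat.Properties as ℕₚ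
open import Data.Nat.Properties using (_!*_!≢0)
open import Data.Nat.DivMod using (_/_; _%_; m*n/n≡m; m/n*n≡m; [m+kn]%n≡m%n; m%n<n; %-distribˡ-*; m%n%n≡m%n; m<n⇒m%n≡m; m≡m%n+[m/n]*n)
open import Data.Nat.GCD using (gcd; gcd[m,n]∣m; gcd[m,n]∣n; gcd-greatest; module Bézout)
open import Data.Nat.Coprimality using (Coprime; coprime-Bézout; gcd≡1⇒coprime)
open import Data.Nat.Divisibility using (_∣_; divides; quotient; ∣-trans; m∣m*n; n∣m*n; *-monoˡ-∣; *-cancelʳ-∣; ∣1⇒≡1; ∣⇒≤)
open import Data.Nat.Primality using (Prime; euclidsLemma; prime⇒nonTrivial; prime⇒irreducible)
open import Data.Nat.Combinatorics using (_C_; nCk≡n!/k![n-k]!; k![n∸k]!∣n!; nCn≡1)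
open import Data.Nat.Tactic.RingSolver using (solve-∀)
open import Data.Fin as Fin using (Fin; toℕ; fromℕ<)
open import Data.Fin.Properties using (toℕ-fromℕ<; toℕ<n; toℕ-injective; punchInᵢ≢i; toℕ-fromℕ; toℕ-inject₁)
open import Data.Fin.Permutation as Perm using (Permutation; permutation; _⟨$⟩ʳ_)
open import Data.List using ([]; _∷_)
open import Data.List.Relation.Unary.All using (All; []; _∷_)
open import Data.Vec.Functional using (rearrange; removeAt)
open import Data.Product using (Σ; ∃; _×_; _,_; proj₁; proj₂)
open import Data.Sum using (inj₁; inj₂)
open import Data.Empty using (⊥-elim)
open import Function using (case_of_)
open import Data.Unit using (⊤; tt)
open import Relation.Nullary using (¬_; Dec; yes; no)
open import Relation.Binary.PropositionalEquality as ≡ using (_≡_; _≢_)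
import Relation.Binary.Reasoning.Setoid as SetoidReasoning
import Algebra.Properties.CommutativeMonoid.Sum as CommutativeMonoidSum
import Algebra.Properties.Semiring.Binomial

prime⇒2≤ : ∀ {p} → Prime p → 2 ≤ p
prime⇒2≤ {p} pr = nonTrivial⇒n>1 p {{prime⇒nonTrivial pr}}

prime∤! : ∀ {p} → Prime p → ∀ a → a < p → ¬ (p ∣ a !)
prime∤! pr zero a<p p∣1 = ℕₚ.<⇒≱ (prime⇒2≤ pr) (∣⇒≤ p∣1)
prime∤! pr (suc a) a<p p∣[1+a]! with euclidsLemma (suc a) (a !) pr p∣[1+a]!
... | inj₁ p∣1+a = ℕₚ.<⇒≱ a<p (∣⇒≤ p∣1+a)
... | inj₂ p∣a! = prime∤! pr a (ℕₚ.<-trans (ℕₚ.n<1+n a) a<p) p∣a!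

prime∣binomial : ∀ {p} → Prime p → ∀ j → 0 < j → j < p → p ∣ p C j
prime∣binomial {p} pr j 0<j j<p with euclidsLemma (p C j) (j ! ℕ.* (p ∸ j) !) pr p∣product
  where
  instance _ = j !* (p ∸ j) !≢0
  n∣n! : ∀ n → 1 ≤ n → n ∣ n !
  n∣n! (suc n) _ = m∣m*n (n !)
  p∣p! : p ∣ p !
  p∣p! = n∣n! p (ℕₚ.≤-trans (s≤s z≤n) (prime⇒2≤ pr))
  p∣product : p ∣ (p C j) ℕ.* (j ! ℕ.* (p ∸ j) !)
  p∣product = ≡.subst (p ∣_)
    (≡.sym (≡.trans (≡.cong (ℕ._* (j ! ℕ.* (p ∸ j) !)) (nCk≡n!/k![n-k]! (ℕₚ.<⇒≤ j<p))) (m/n*n≡m (k![n∸k]!∣n! (ℕₚ.<⇒≤ j<p)))))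
    p∣p!
... | inj₁ p∣pCj = p∣pCj
... | inj₂ p∣rest with euclidsLemma (j !) ((p ∸ j) !) pr p∣rest
...   | inj₁ p∣j! = ⊥-elim (prime∤! pr j j<p p∣j!)
...   | inj₂ p∣[p-j]! = ⊥-elim (prime∤! pr (p ∸ j) (ℕₚ.∸-monoʳ-< 0<j (ℕₚ.<⇒≤ j<p)) p∣[p-j]!)

2≤^ : ∀ B k → 2 ≤ B → 1 ≤ k → 2 ≤ B ℕ.^ k
2≤^ B (suc k) 2≤B _ = ℕₚ.≤-trans 2≤B (ℕₚ.m≤m*n B (B ℕ.^ k) {{ℕₚ.m^n≢0 B k {{ℕ.>-nonZero (ℕₚ.≤-trans (s≤s z≤n) 2≤B)}}}})

divN-* : ∀ a c → 1 ≤ c → divN (a ℕ.* c) c ≡ a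
divN-* a (suc c) _ = m*n/n≡m a (suc c)

geom : ℕ → ℕ → ℕ
geom B zero = 0
geom B (suc k) = 1 ℕ.+ B ℕ.* geom B k

geom-suc : ∀ B k → geom B (suc k) ≡ geom B k ℕ.+ B ℕ.^ k
geom-suc B zero = ≡.cong suc (ℕₚ.*-zeroʳ B)
geom-suc B (suc k) = ≡.trans (≡.cong (λ g → 1 ℕ.+ B ℕ.* g) (geom-suc B k)) (lemma B (geom B k) (B ℕ.^ k))
  where
  lemma : ∀ B g c → 1 ℕ.+ B ℕ.* (g ℕ.+ c) ≡ 1 ℕ.+ B ℕ.* g ℕ.+ B ℕ.* c
  lemma = solve-∀

pred*geom+1≡^ : ∀ B k → 1 ≤ B → (B ∸ 1) ℕ.* geom B k ℕ.+ 1 ≡ B ℕ.^ k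
pred*geom+1≡^ (suc B) zero _ = ≡.cong (ℕ._+ 1) (ℕₚ.*-zeroʳ B)
pred*geom+1≡^ (suc B) (suc k) 1≤B = ≡.trans (lemma B (geom (suc B) k)) (≡.cong (suc B ℕ.*_) (pred*geom+1≡^ (suc B) k 1≤B))
  where
  lemma : ∀ B g → B ℕ.* (1 ℕ.+ suc B ℕ.* g) ℕ.+ 1 ≡ suc B ℕ.* (B ℕ.* g ℕ.+ 1)
  lemma = solve-∀

divN-geom : ∀ B k → 2 ≤ B → divN (B ℕ.^ k ∸ 1) (B ∸ 1) ≡ geom B k
divN-geom (suc (suc B)) k _ = begin
  divN (suc (suc B) ℕ.^ k ∸ 1) (suc B)                 ≡⟨ ≡.cong (λ e → divN (e ∸ 1) (suc B)) (≡.sym (pred*geom+1≡^ (suc (suc B)) k (s≤s z≤n))) ⟩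
  divN (suc B ℕ.* geom (suc (suc B)) k ℕ.+ 1 ∸ 1) (suc B) ≡⟨ ≡.cong (λ e → divN e (suc B)) (ℕₚ.m+n∸n≡m (suc B ℕ.* geom (suc (suc B)) k) 1) ⟩
  divN (suc B ℕ.* geom (suc (suc B)) k) (suc B)         ≡⟨ ≡.cong (λ e → divN e (suc B)) (ℕₚ.*-comm (suc B) (geom (suc (suc B)) k)) ⟩
  divN (geom (suc (suc B)) k ℕ.* suc B) (suc B)         ≡⟨ divN-* _ (suc B) (s≤s z≤n) ⟩
  geom (suc (suc B)) k                                  ∎
  where open ≡.≡-Reasoning
divN-geom (suc zero) k (s≤s ())

record GcdQuotients (m n r : ℕ) : Set where
  field
    t s : ℕ
    m≡t*d : m ≡ t ℕ.* gcd m r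
    r≡s*d : r ≡ s ℕ.* gcd m r
    1≤d : 1 ≤ gcd m r
    coprime[s,t] : Coprime s t
    coprime[s,n] : Coprime s n

-- From gcd m r = gcd (m n) r: a common divisor i of s = r/d and t n gives i d ∣ gcd (m n) r = d.
gcdQuotients : ∀ m n r → 1 ≤ m → gcd m r ≡ gcd (m ℕ.* n) r → GcdQuotients m n r
gcdQuotients m n r 1≤m d≡d′ = record
  { t = t ; s = s ; m≡t*d = ≡.sym t*d≡m ; r≡s*d = ≡.sym s*d≡r ; 1≤d = 1≤d
  ; coprime[s,t] = λ (i∣s , i∣t) → coprime[s,tn] (i∣s , ∣-trans i∣t (m∣m*n n))
  ; coprime[s,n] = λ (i∣s , i∣n) → coprime[s,tn] (i∣s , ∣-trans i∣n (n∣m*n t)) }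
  where
  d = gcd m r
  t = quotient (gcd[m,n]∣m m r)
  s = quotient (gcd[m,n]∣n m r)
  t*d≡m : t ℕ.* d ≡ m
  t*d≡m = ≡.sym (_∣_.equality (gcd[m,n]∣m m r))
  s*d≡r : s ℕ.* d ≡ r
  s*d≡r = ≡.sym (_∣_.equality (gcd[m,n]∣n m r))
  1≤d : 1 ≤ d
  1≤d = ℕₚ.n≢0⇒n>0 λ d≡0 → ℕₚ.<⇒≱ 1≤m (ℕₚ.≤-reflexive (≡.trans (≡.sym t*d≡m) (≡.trans (≡.cong (t ℕ.*_) d≡0) (ℕₚ.*-zeroʳ t))))
  coprime[s,tn] : Coprime s (t ℕ.* n)
  coprime[s,tn] {i} (i∣s , i∣tn) = ∣1⇒≡1 (*-cancelʳ-∣ d {{ℕ.>-nonZero 1≤d}} (≡.subst (i ℕ.* d ∣_) (≡.sym (ℕₚ.*-identityˡ d)) id∣d))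
    where
    swap : ∀ a b c → a ℕ.* b ℕ.* c ≡ a ℕ.* c ℕ.* b
    swap = solve-∀
    id∣mn : i ℕ.* d ∣ m ℕ.* n
    id∣mn = ≡.subst (i ℕ.* d ∣_) (≡.trans (swap t n d) (≡.cong (ℕ._* n) t*d≡m)) (*-monoˡ-∣ d i∣tn)
    id∣d : i ℕ.* d ∣ d
    id∣d = ≡.subst (i ℕ.* d ∣_) (≡.sym d≡d′) (gcd-greatest id∣mn (≡.subst (i ℕ.* d ∣_) s*d≡r (*-monoˡ-∣ d i∣s)))

∃-inverse-mod : ∀ s t → .{{_ : NonZero t}} → Coprime s t → ∃ λ s′ → (s′ ℕ.* s) % t ≡ 1 % t
∃-inverse-mod s t coprime with coprime-Bézout coprime
... | Bézout.+- x y eq = x , ≡.trans (≡.cong (_% t) (≡.sym eq)) ([m+kn]%n≡m%n 1 y t)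
∃-inverse-mod s (suc b) coprime | Bézout.-+ x y eq = x ℕ.* b , (begin
  (x ℕ.* b ℕ.* s) % t                    ≡⟨ ≡.sym ([m+kn]%n≡m%n (x ℕ.* b ℕ.* s) 1 t) ⟩
  (x ℕ.* b ℕ.* s ℕ.+ 1 ℕ.* t) % t        ≡⟨ ≡.cong (_% t) (lemma₁ x b s) ⟩
  (b ℕ.* (1 ℕ.+ x ℕ.* s) ℕ.+ 1) % t      ≡⟨ ≡.cong (λ u → (b ℕ.* u ℕ.+ 1) % t) eq ⟩
  (b ℕ.* (y ℕ.* t) ℕ.+ 1) % t            ≡⟨ ≡.cong (_% t) (lemma₂ y b) ⟩
  (1 ℕ.+ (y ℕ.* b) ℕ.* t) % t            ≡⟨ [m+kn]%n≡m%n 1 (y ℕ.* b) t ⟩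
  1 % t                                  ∎)
  where
  open ≡.≡-Reasoning
  t = suc b
  lemma₁ : ∀ x b s → x ℕ.* b ℕ.* s ℕ.+ 1 ℕ.* suc b ≡ b ℕ.* (1 ℕ.+ x ℕ.* s) ℕ.+ 1
  lemma₁ = solve-∀
  lemma₂ : ∀ y b → b ℕ.* (y ℕ.* suc b) ℕ.+ 1 ≡ 1 ℕ.+ (y ℕ.* b) ℕ.* suc b
  lemma₂ = solve-∀

module _ (t : ℕ) .{{_ : NonZero t}} where
  private
    mul-mod : ℕ → Fin t → Fin t
    mul-mod u i = fromℕ< (m%n<n (u ℕ.* toℕ i) t)

    mul-mod-inverse : ∀ u v → (u ℕ.* v) % t ≡ 1 % t → ∀ i → mul-mod u (mul-mod v i) ≡ i
    mul-mod-inverse u v uv≡1 i = toℕ-injective (begin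
      toℕ (mul-mod u (mul-mod v i))             ≡⟨ toℕ-fromℕ< _ ⟩
      (u ℕ.* toℕ (mul-mod v i)) % t             ≡⟨ ≡.cong (λ z → (u ℕ.* z) % t) (toℕ-fromℕ< _) ⟩
      (u ℕ.* ((v ℕ.* toℕ i) % t)) % t           ≡⟨ %-distribˡ-* u _ t ⟩
      ((u % t) ℕ.* ((v ℕ.* toℕ i) % t % t)) % t ≡⟨ ≡.cong (λ z → ((u % t) ℕ.* z) % t) (m%n%n≡m%n (v ℕ.* toℕ i) t) ⟩
      ((u % t) ℕ.* ((v ℕ.* toℕ i) % t)) % t     ≡⟨ ≡.sym (%-distribˡ-* u (v ℕ.* toℕ i) t) ⟩
      (u ℕ.* (v ℕ.* toℕ i)) % t                 ≡⟨ ≡.cong (_% t) (≡.sym (ℕₚ.*-assoc u v (toℕ i))) ⟩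
      (u ℕ.* v ℕ.* toℕ i) % t                   ≡⟨ %-distribˡ-* (u ℕ.* v) (toℕ i) t ⟩
      (((u ℕ.* v) % t) ℕ.* (toℕ i % t)) % t     ≡⟨ ≡.cong (λ z → (z ℕ.* (toℕ i % t)) % t) uv≡1 ⟩
      ((1 % t) ℕ.* (toℕ i % t)) % t             ≡⟨ ≡.sym (%-distribˡ-* 1 (toℕ i) t) ⟩
      (1 ℕ.* toℕ i) % t                         ≡⟨ ≡.cong (_% t) (ℕₚ.*-identityˡ (toℕ i)) ⟩
      toℕ i % t                                 ≡⟨ m<n⇒m%n≡m (toℕ<n i) ⟩
      toℕ i                                     ∎)
      where open ≡.≡-Reasoning

  *-mod-permutation : ∀ s → Coprime s t → Σ (Permutation t t) λ π → ∀ i → toℕ (π ⟨$⟩ʳ i) ≡ (s ℕ.* toℕ i) % t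
  *-mod-permutation s coprime =
    permutation (mul-mod s) (mul-mod s′) (mul-mod-inverse s s′ (≡.trans (≡.cong (_% t) (ℕₚ.*-comm s s′)) s′s≡1)) (mul-mod-inverse s′ s s′s≡1)
    , λ i → toℕ-fromℕ< _
    where
    s′ = proj₁ (∃-inverse-mod s t coprime)
    s′s≡1 = proj₂ (∃-inverse-mod s t coprime)

module BigOperator {c ℓ} (M : CommutativeMonoid c ℓ) where
  open CommutativeMonoid M
  open CommutativeMonoidSum M using (sum; sum-permute; sum-cong-≋)
  open SetoidReasoning setoid

  big : ℕ → (ℕ → Carrier) → Carrier
  big zero g = ε
  big (suc k) g = big k g ∙ g k

  big-cong : ∀ k {g h : ℕ → Carrier} → (∀ i → i < k → g i ≈ h i) → big k g ≈ big k h
  big-cong zero eq = refl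
  big-cong (suc k) eq = ∙-cong (big-cong k (λ i i<k → eq i (ℕₚ.m<n⇒m<1+n i<k))) (eq k (ℕₚ.n<1+n k))

  big-suc-head : ∀ k g → big (suc k) g ≈ g 0 ∙ big k (λ i → g (suc i))
  big-suc-head zero g = trans (identityˡ _) (sym (identityʳ _))
  big-suc-head (suc k) g = trans (∙-congʳ (big-suc-head k g)) (assoc _ _ _)

  big≈sum : ∀ k g → big k g ≈ sum {k} (λ i → g (toℕ i))
  big≈sum zero g = refl
  big≈sum (suc k) g = trans (big-suc-head k g) (∙-congˡ (big≈sum k (λ i → g (suc i))))

  big-ε : ∀ k → big k (λ _ → ε) ≈ ε
  big-ε zero = refl
  big-ε (suc k) = trans (identityʳ _) (big-ε k)

  big-∙ : ∀ k (g h : ℕ → Carrier) → big k (λ i → g i ∙ h i) ≈ big k g ∙ big k h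
  big-∙ zero g h = sym (identityˡ ε)
  big-∙ (suc k) g h = trans (∙-congʳ (big-∙ k g h)) (interchange _ _ _ _)
    where open import Algebra.Properties.CommutativeSemigroup commutativeSemigroup using (interchange)

  big-+ : ∀ k l g → big (k ℕ.+ l) g ≈ big k g ∙ big l (λ i → g (k ℕ.+ i))
  big-+ k zero g = trans (reflexive (≡.cong (λ u → big u g) (ℕₚ.+-identityʳ k))) (sym (identityʳ _))
  big-+ k (suc l) g = begin
    big (k ℕ.+ suc l) g                               ≡⟨ ≡.cong (λ u → big u g) (ℕₚ.+-suc k l) ⟩
    big (k ℕ.+ l) g ∙ g (k ℕ.+ l)                     ≈⟨ ∙-congʳ (big-+ k l g) ⟩
    (big k g ∙ big l (λ i → g (k ℕ.+ i))) ∙ g (k ℕ.+ l) ≈⟨ assoc _ _ _ ⟩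
    big k g ∙ big (suc l) (λ i → g (k ℕ.+ i))         ∎

  big-periodic : ∀ t a g → (∀ j → g (t ℕ.+ j) ≈ g j) → big (a ℕ.* t) g ≈ big a (λ _ → big t g)
  big-periodic t zero g periodic = refl
  big-periodic t (suc a) g periodic = begin
    big (t ℕ.+ a ℕ.* t) g                       ≈⟨ big-+ t (a ℕ.* t) g ⟩
    big t g ∙ big (a ℕ.* t) (λ i → g (t ℕ.+ i)) ≈⟨ ∙-congˡ (big-cong (a ℕ.* t) (λ i _ → periodic i)) ⟩
    big t g ∙ big (a ℕ.* t) g                   ≈⟨ ∙-congˡ (big-periodic t a g periodic) ⟩
    big t g ∙ big a (λ _ → big t g)             ≈⟨ comm _ _ ⟩
    big (suc a) (λ _ → big t g)                 ∎

  big-reindex-*-mod : ∀ t .{{_ : NonZero t}} s → Coprime s t → ∀ g → big t (λ j → g ((s ℕ.* j) % t)) ≈ big t g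
  big-reindex-*-mod t s coprime g = begin
    big t (λ j → g ((s ℕ.* j) % t))                    ≈⟨ big≈sum t _ ⟩
    sum {t} (λ i → g ((s ℕ.* toℕ i) % t))              ≈⟨ sum-cong-≋ (λ i → reflexive (≡.cong g (≡.sym (proj₂ π i)))) ⟩
    sum {t} (rearrange (proj₁ π ⟨$⟩ʳ_) (λ i → g (toℕ i))) ≈⟨ sym (sum-permute (λ i → g (toℕ i)) (proj₁ π)) ⟩
    sum {t} (λ i → g (toℕ i))                          ≈⟨ sym (big≈sum t g) ⟩
    big t g                                            ∎
    where π = *-mod-permutation t s coprime

InverseOnNonzero : (R : CommutativeRing 0ℓ 0ℓ) → (CommutativeRing.Carrier R → CommutativeRing.Carrier R) → Set
InverseOnNonzero R inv = ∀ x → ¬ (x ≈ 0#) → x * inv x ≈ 1#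
  where open CommutativeRing R

Nontrivial : CommutativeRing 0ℓ 0ℓ → Set
Nontrivial R = ¬ (1# ≈ 0#)
  where open CommutativeRing R

module _ (R : CommutativeRing 0ℓ 0ℓ) (inv : CommutativeRing.Carrier R → CommutativeRing.Carrier R) (p m n r : ℕ) where
  open CommutativeRing R
  open Setup R inv p m n r using (HasSize)

  HasSize⇒Nontrivial : ∀ N → 2 ≤ N → HasSize N → Nontrivial R
  HasSize⇒Nontrivial (suc (suc N)) _ (e , e-injective , _) 1≈0 with e-injective Fin.zero (Fin.suc Fin.zero) (trans (≈0 _) (sym (≈0 _)))
    where
    ≈0 : ∀ x → x ≈ 0#
    ≈0 x = trans (sym (*-identityʳ x)) (trans (*-congˡ 1≈0) (zeroʳ x))
  ... | ()
  HasSize⇒Nontrivial (suc zero) (s≤s ()) _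

-- p m n r are parameters only because pow, _·_ and Σ< are defined inside Setup.
module Field (R : CommutativeRing 0ℓ 0ℓ) (inv : CommutativeRing.Carrier R → CommutativeRing.Carrier R)
             (x*inv≈1 : InverseOnNonzero R inv) (1≉0 : Nontrivial R) (p m n r : ℕ) where
  open CommutativeRing R

  open Setup R inv p m n r public
  open SetoidReasoning setoid public
  open import Algebra.Properties.CommutativeSemigroup *-commutativeSemigroup public
    using () renaming (interchange to *-interchange; x∙yz≈y∙xz to x*yz≈y*xz)
  open import Algebra.Properties.CommutativeSemigroup +-commutativeSemigroup public
    using () renaming (interchange to +-interchange; xy∙z≈xz∙y to xy+z≈xz+y)
  open import Algebra.Properties.Group +-group public
    using ()
    renaming (ε⁻¹≈ε to -0#≈0#; inverseʳ-unique to -‿unique; ⁻¹-involutive to -‿involutive;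
              ∙-cancelʳ to +-cancelʳ; x∙y⁻¹≈ε⇒x≈y to x-y≈0⇒x≈y)
  open import Algebra.Properties.AbelianGroup +-abelianGroup public
    using () renaming (⁻¹-∙-comm to -x+-y≈-[x+y])
  open import Algebra.Properties.Ring ring public
    using (-‿distribˡ-*; -‿distribʳ-*)

  module Add = BigOperator +-commutativeMonoid
  module Mul = BigOperator *-commutativeMonoid

  x+[y-x]≈y : ∀ x y → x + (y - x) ≈ y
  x+[y-x]≈y x y = begin
    x + (y - x)   ≈⟨ +-congˡ (+-comm y (- x)) ⟩
    x + (- x + y) ≈⟨ sym (+-assoc _ _ _) ⟩
    (x - x) + y   ≈⟨ +-congʳ (-‿inverseʳ x) ⟩
    0# + y        ≈⟨ +-identityˡ y ⟩
    y             ∎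

  [x+y]-x≈y : ∀ x y → (x + y) - x ≈ y
  [x+y]-x≈y x y = trans (+-congʳ (+-comm x y)) (trans (+-assoc y x (- x)) (trans (+-congˡ (-‿inverseʳ x)) (+-identityʳ y)))

  [x-y]+y≈x : ∀ x y → (x - y) + y ≈ x
  [x-y]+y≈x x y = trans (+-assoc x (- y) y) (trans (+-congˡ (-‿inverseˡ y)) (+-identityʳ x))

  pow-cong : ∀ {x y} k → x ≈ y → pow x k ≈ pow y k
  pow-cong zero eq = refl
  pow-cong (suc k) eq = *-cong eq (pow-cong k eq)

  pow-+ : ∀ x a b → pow x (a ℕ.+ b) ≈ pow x a * pow x b
  pow-+ x zero b = sym (*-identityˡ _)
  pow-+ x (suc a) b = trans (*-congˡ (pow-+ x a b)) (sym (*-assoc _ _ _))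

  pow-distrib-* : ∀ x y k → pow (x * y) k ≈ pow x k * pow y k
  pow-distrib-* x y zero = sym (*-identityˡ 1#)
  pow-distrib-* x y (suc k) = trans (*-congˡ (pow-distrib-* x y k)) (*-interchange x y _ _)

  pow-1# : ∀ k → pow 1# k ≈ 1#
  pow-1# zero = refl
  pow-1# (suc k) = trans (*-identityˡ _) (pow-1# k)

  pow-0# : ∀ k → 1 ≤ k → pow 0# k ≈ 0#
  pow-0# (suc k) _ = zeroˡ _

  pow-* : ∀ x a b → pow x (a ℕ.* b) ≈ pow (pow x a) b
  pow-* x zero b = sym (pow-1# b)
  pow-* x (suc a) b = begin
    pow x (b ℕ.+ a ℕ.* b)           ≈⟨ pow-+ x b (a ℕ.* b) ⟩
    pow x b * pow x (a ℕ.* b)       ≈⟨ *-congˡ (pow-* x a b) ⟩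
    pow x b * pow (pow x a) b       ≈⟨ sym (pow-distrib-* x (pow x a) b) ⟩
    pow (x * pow x a) b             ∎

  pow-comm : ∀ x a b → pow (pow x a) b ≈ pow (pow x b) a
  pow-comm x a b = trans (sym (pow-* x a b)) (trans (reflexive (≡.cong (pow x) (ℕₚ.*-comm a b))) (pow-* x b a))

  ·-cong : ∀ k {x y} → x ≈ y → k · x ≈ k · y
  ·-cong zero eq = refl
  ·-cong (suc k) eq = +-cong eq (·-cong k eq)

  ·-+ : ∀ a b x → (a ℕ.+ b) · x ≈ a · x + b · x
  ·-+ zero b x = sym (+-identityˡ _)
  ·-+ (suc a) b x = trans (+-congˡ (·-+ a b x)) (sym (+-assoc _ _ _))

  ·≈·1#* : ∀ k x → k · x ≈ (k · 1#) * x
  ·≈·1#* zero x = sym (zeroˡ x)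
  ·≈·1#* (suc k) x = trans (+-cong (sym (*-identityˡ x)) (·≈·1#* k x)) (sym (distribʳ x 1# (k · 1#)))

  ·1#-homo-* : ∀ a b → (a ℕ.* b) · 1# ≈ (a · 1#) * (b · 1#)
  ·1#-homo-* zero b = sym (zeroˡ _)
  ·1#-homo-* (suc a) b = begin
    (b ℕ.+ a ℕ.* b) · 1#                  ≈⟨ ·-+ b (a ℕ.* b) 1# ⟩
    b · 1# + (a ℕ.* b) · 1#               ≈⟨ +-cong (sym (*-identityˡ _)) (·1#-homo-* a b) ⟩
    1# * (b · 1#) + (a · 1#) * (b · 1#)   ≈⟨ sym (distribʳ _ 1# _) ⟩
    (1# + a · 1#) * (b · 1#)              ∎

  ·-comm-* : ∀ k c x → k · (c * x) ≈ c * (k · x)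
  ·-comm-* k c x = trans (·≈·1#* k _) (trans (x*yz≈y*xz _ c x) (*-congˡ (sym (·≈·1#* k x))))

  ·-0# : ∀ k → k · 0# ≈ 0#
  ·-0# k = trans (·≈·1#* k 0#) (zeroʳ _)

  pow-·1# : ∀ a b → pow (a · 1#) b ≈ (a ℕ.^ b) · 1#
  pow-·1# a zero = sym (+-identityʳ 1#)
  pow-·1# a (suc b) = trans (*-congˡ (pow-·1# a b)) (sym (·1#-homo-* a (a ℕ.^ b)))

  Add-big-const : ∀ k c → Add.big k (λ _ → c) ≈ k · c
  Add-big-const zero c = refl
  Add-big-const (suc k) c = trans (+-comm _ c) (+-congˡ (Add-big-const k c))

  Mul-big-const : ∀ k c → Mul.big k (λ _ → c) ≈ pow c k
  Mul-big-const zero c = refl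
  Mul-big-const (suc k) c = trans (*-comm _ c) (*-congˡ (Mul-big-const k c))

  inv*x≈1 : ∀ x → ¬ (x ≈ 0#) → inv x * x ≈ 1#
  inv*x≈1 x x≉0 = trans (*-comm _ _) (x*inv≈1 x x≉0)

  inv-cancelˡ : ∀ x y → ¬ (x ≈ 0#) → inv x * (x * y) ≈ y
  inv-cancelˡ x y x≉0 = trans (sym (*-assoc _ _ _)) (trans (*-congʳ (inv*x≈1 x x≉0)) (*-identityˡ y))

  inv-cancelʳ : ∀ x y → ¬ (x ≈ 0#) → x * (inv x * y) ≈ y
  inv-cancelʳ x y x≉0 = trans (sym (*-assoc _ _ _)) (trans (*-congʳ (x*inv≈1 x x≉0)) (*-identityˡ y))

  *-cancelˡ : ∀ x y z → ¬ (x ≈ 0#) → x * y ≈ x * z → y ≈ z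
  *-cancelˡ x y z x≉0 eq = trans (sym (inv-cancelˡ x y x≉0)) (trans (*-congˡ eq) (inv-cancelˡ x z x≉0))

  *-≉0 : ∀ x y → ¬ (x ≈ 0#) → ¬ (y ≈ 0#) → ¬ (x * y ≈ 0#)
  *-≉0 x y x≉0 y≉0 xy≈0 = y≉0 (*-cancelˡ x y 0# x≉0 (trans xy≈0 (sym (zeroʳ x))))

  pow-≉0 : ∀ x k → ¬ (x ≈ 0#) → ¬ (pow x k ≈ 0#)
  pow-≉0 x zero x≉0 = 1≉0
  pow-≉0 x (suc k) x≉0 = *-≉0 x _ x≉0 (pow-≉0 x k x≉0)

  inv-unique : ∀ x y → x * y ≈ 1# → y ≈ inv x
  inv-unique x y xy≈1 = *-cancelˡ x y (inv x) x≉0 (trans xy≈1 (sym (x*inv≈1 x x≉0)))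
    where
    x≉0 : ¬ (x ≈ 0#)
    x≉0 x≈0 = 1≉0 (trans (sym xy≈1) (trans (*-congʳ x≈0) (zeroˡ y)))

  inv-≉0 : ∀ x → ¬ (x ≈ 0#) → ¬ (inv x ≈ 0#)
  inv-≉0 x x≉0 inv≈0 = 1≉0 (trans (sym (x*inv≈1 x x≉0)) (trans (*-congˡ inv≈0) (zeroʳ x)))

  inv-cong : ∀ {x y} → ¬ (x ≈ 0#) → x ≈ y → inv x ≈ inv y
  inv-cong {x} {y} x≉0 x≈y = inv-unique y (inv x) (trans (*-congʳ (sym x≈y)) (x*inv≈1 x x≉0))

  pow-inv : ∀ x k → ¬ (x ≈ 0#) → pow (inv x) k ≈ inv (pow x k)
  pow-inv x k x≉0 = inv-unique (pow x k) (pow (inv x) k)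
    (trans (sym (pow-distrib-* x (inv x) k)) (trans (pow-cong k (x*inv≈1 x x≉0)) (pow-1# k)))

  pow-*≈1 : ∀ {x} k j → pow x k ≈ 1# → pow x (j ℕ.* k) ≈ 1#
  pow-*≈1 {x} k j xᵏ≈1 = trans (reflexive (≡.cong (pow x) (ℕₚ.*-comm j k))) (trans (pow-* x k j) (trans (pow-cong j xᵏ≈1) (pow-1# j)))

  inv-1# : inv 1# ≈ 1#
  inv-1# = sym (inv-unique 1# 1# (*-identityˡ 1#))

  module FiniteField (N₀ : ℕ) (hs : HasSize (suc N₀)) where
    private
      N = suc N₀
      e : Fin N → Carrier
      e = proj₁ hs
      e-injective : ∀ i j → e i ≈ e j → i ≡ j
      e-injective = proj₁ (proj₂ hs)
      index : Carrier → Fin N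
      index x = proj₁ (proj₂ (proj₂ hs) x)
      e∘index : ∀ x → e (index x) ≈ x
      e∘index x = proj₂ (proj₂ (proj₂ hs) x)
      module Sum = CommutativeMonoidSum +-commutativeMonoid
      module Product = CommutativeMonoidSum *-commutativeMonoid

    _≟_ : ∀ x y → Dec (x ≈ y)
    x ≟ y with index x Fin.≟ index y
    ... | yes eq = yes (trans (sym (e∘index x)) (trans (reflexive (≡.cong e eq)) (e∘index y)))
    ... | no ne = no λ x≈y → ne (e-injective _ _ (trans (e∘index x) (trans x≈y (sym (e∘index y)))))

    private
      bijection⇒permutation : (g h : Carrier → Carrier) → (∀ {x y} → x ≈ y → g x ≈ g y) →
        (∀ {x y} → x ≈ y → h x ≈ h y) → (∀ x → h (g x) ≈ x) → (∀ x → g (h x) ≈ x) →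
        Σ (Permutation N N) λ π → ∀ i → e (π ⟨$⟩ʳ i) ≈ g (e i)
      bijection⇒permutation g h g-cong h-cong hg gh = permutation g′ h′ g′h′ h′g′ , λ i → e∘index _
        where
        g′ h′ : Fin N → Fin N
        g′ i = index (g (e i))
        h′ i = index (h (e i))
        g′h′ : ∀ i → g′ (h′ i) ≡ i
        g′h′ i = e-injective _ _ (trans (e∘index _) (trans (g-cong (e∘index _)) (gh (e i))))
        h′g′ : ∀ i → h′ (g′ i) ≡ i
        h′g′ i = e-injective _ _ (trans (e∘index _) (trans (h-cong (e∘index _)) (hg (e i))))

    -- Translating by c permutes the elements, so Σ x = Σ (x + c) = Σ x + N·c.
    size·≈0 : ∀ c → N · c ≈ 0#
    size·≈0 c = sym (+-cancelʳ (Sum.sum e) 0# (N · c) (begin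
      0# + Sum.sum e                          ≈⟨ +-identityˡ _ ⟩
      Sum.sum e                               ≈⟨ Sum.sum-permute e π ⟩
      Sum.sum (rearrange (π ⟨$⟩ʳ_) e)          ≈⟨ Sum.sum-cong-≋ (proj₂ translation) ⟩
      Sum.sum (λ i → e i + c)                 ≈⟨ Sum.∑-distrib-+ e (λ _ → c) ⟩
      Sum.sum e + Sum.sum {N} (λ _ → c)       ≈⟨ +-congˡ (trans (sym (Add.big≈sum N (λ _ → c))) (Add-big-const N c)) ⟩
      Sum.sum e + N · c                       ≈⟨ +-comm _ _ ⟩
      N · c + Sum.sum e                       ∎))
      where
      translation = bijection⇒permutation (_+ c) (_- c) +-congʳ +-congʳ
        (λ x → trans (+-assoc x c (- c)) (trans (+-congˡ (-‿inverseʳ c)) (+-identityʳ x))) (λ x → [x-y]+y≈x x c)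
      π = proj₁ translation

    -- Multiplying by c ≠ 0 permutes the nonzero elements; comparing the products of all elements,
    -- with 0 replaced by 1, gives c^(N-1) = 1.
    module _ (c : Carrier) (c≉0 : ¬ (c ≈ 0#)) where
      private
        i₀ = index 0#
        if-i₀ : ∀ {P : Set} → Dec P → Carrier → Carrier → Carrier
        if-i₀ (yes _) x y = y
        if-i₀ (no _) x y = x
        e′ : Fin N → Carrier
        e′ i = if-i₀ (i Fin.≟ i₀) (e i) 1#
        factor : Fin N → Carrier
        factor i = if-i₀ (i Fin.≟ i₀) c 1#
        scaling = bijection⇒permutation (c *_) (inv c *_) *-congˡ *-congˡ (λ x → inv-cancelˡ c x c≉0) (λ x → inv-cancelʳ c x c≉0)
        π = proj₁ scaling
        πi₀≡i₀ : π ⟨$⟩ʳ i₀ ≡ i₀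
        πi₀≡i₀ = e-injective _ _ (trans (proj₂ scaling i₀) (trans (*-congˡ (e∘index 0#)) (trans (zeroʳ c) (sym (e∘index 0#)))))
        πi≢i₀ : ∀ i → i ≢ i₀ → π ⟨$⟩ʳ i ≢ i₀
        πi≢i₀ i i≢i₀ eq = i≢i₀ (≡.trans (≡.sym (Perm.inverseˡ π)) (≡.trans (≡.cong (π Perm.⟨$⟩ˡ_) (≡.trans eq (≡.sym πi₀≡i₀))) (Perm.inverseˡ π)))
        e′∘π : ∀ i → e′ (π ⟨$⟩ʳ i) ≈ factor i * e′ i
        e′∘π i with i Fin.≟ i₀
        ... | yes ≡.refl rewrite πi₀≡i₀ with i₀ Fin.≟ i₀
        ...   | yes _ = sym (*-identityˡ 1#)
        ...   | no ne = ⊥-elim (ne ≡.refl)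
        e′∘π i | no i≢i₀ with π ⟨$⟩ʳ i Fin.≟ i₀
        ...   | yes eq = ⊥-elim (πi≢i₀ i i≢i₀ eq)
        ...   | no _ = proj₂ scaling i
        e′≉0 : ∀ i → ¬ (e′ i ≈ 0#)
        e′≉0 i with i Fin.≟ i₀
        ... | yes _ = 1≉0
        ... | no i≢i₀ = λ eᵢ≈0 → i≢i₀ (e-injective _ _ (trans eᵢ≈0 (sym (e∘index 0#))))
        product-≉0 : ∀ {k} (v : Fin k → Carrier) → (∀ i → ¬ (v i ≈ 0#)) → ¬ (Product.sum v ≈ 0#)
        product-≉0 {zero} v v≉0 = 1≉0
        product-≉0 {suc k} v v≉0 = *-≉0 _ _ (v≉0 Fin.zero) (product-≉0 (λ i → v (Fin.suc i)) (λ i → v≉0 (Fin.suc i)))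
        factor-punchIn : ∀ j → factor (Fin.punchIn i₀ j) ≈ c
        factor-punchIn j with Fin.punchIn i₀ j Fin.≟ i₀
        ... | yes eq = ⊥-elim (punchInᵢ≢i i₀ j eq)
        ... | no _ = refl
        factor-i₀ : factor i₀ ≈ 1#
        factor-i₀ with i₀ Fin.≟ i₀
        ... | yes _ = refl
        ... | no ne = ⊥-elim (ne ≡.refl)
        ∏factor≈1 : Product.sum factor ≈ 1#
        ∏factor≈1 = *-cancelˡ (Product.sum e′) _ _ (product-≉0 e′ e′≉0) (begin
          Product.sum e′ * Product.sum factor        ≈⟨ *-comm _ _ ⟩
          Product.sum factor * Product.sum e′        ≈⟨ sym (Product.∑-distrib-+ factor e′) ⟩
          Product.sum (λ i → factor i * e′ i)        ≈⟨ Product.sum-cong-≋ (λ i → sym (e′∘π i)) ⟩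
          Product.sum (rearrange (π ⟨$⟩ʳ_) e′)       ≈⟨ sym (Product.sum-permute e′ π) ⟩
          Product.sum e′                             ≈⟨ sym (*-identityʳ _) ⟩
          Product.sum e′ * 1#                        ∎)

      fermat-≉0 : pow c N ≈ c
      fermat-≉0 = begin
        c * pow c N₀                                ≈⟨ *-congˡ (sym (Mul-big-const N₀ c)) ⟩
        c * Mul.big N₀ (λ _ → c)                    ≈⟨ *-congˡ (Mul.big≈sum N₀ (λ _ → c)) ⟩
        c * Product.sum {N₀} (λ _ → c)              ≈⟨ *-congˡ (Product.sum-cong-≋ (λ j → sym (factor-punchIn j))) ⟩
        c * Product.sum (removeAt factor i₀)        ≈⟨ *-congˡ (sym (*-identityˡ _)) ⟩
        c * (1# * Product.sum (removeAt factor i₀)) ≈⟨ *-congˡ (*-congʳ (sym factor-i₀)) ⟩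
        c * (factor i₀ * Product.sum (removeAt factor i₀)) ≈⟨ *-congˡ (sym (Product.sum-remove {i = i₀} factor)) ⟩
        c * Product.sum factor                      ≈⟨ *-congˡ ∏factor≈1 ⟩
        c * 1#                                      ≈⟨ *-identityʳ c ⟩
        c                                           ∎

    fermat : ∀ c → pow c N ≈ c
    fermat c with c ≟ 0#
    ... | yes c≈0 = trans (pow-cong N c≈0) (trans (pow-0# N (s≤s z≤n)) (sym c≈0))
    ... | no c≉0 = fermat-≉0 c c≉0

  ∣⇒·≈0 : ∀ {q} → q · 1# ≈ 0# → ∀ j z → q ∣ j → j · z ≈ 0#
  ∣⇒·≈0 {q} q·1#≈0 j z (divides c j≡cq) = begin
    j · z                        ≡⟨ ≡.cong (_· z) j≡cq ⟩
    (c ℕ.* q) · z                ≈⟨ ·≈·1#* (c ℕ.* q) z ⟩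
    ((c ℕ.* q) · 1#) * z         ≈⟨ *-congʳ (·1#-homo-* c q) ⟩
    ((c · 1#) * (q · 1#)) * z    ≈⟨ *-congʳ (trans (*-congˡ q·1#≈0) (zeroʳ _)) ⟩
    0# * z                       ≈⟨ zeroˡ z ⟩
    0#                           ∎

  -- Binomial theorem, in which all middle binomial coefficients q C j vanish.
  pow-+-prime : ∀ q → Prime q → q · 1# ≈ 0# → ∀ x y → pow (x + y) q ≈ pow x q + pow y q
  pow-+-prime (suc k) pr q·1#≈0 x y = begin
    pow (x + y) (suc k)                        ≈⟨ pow≈^ (x + y) (suc k) ⟩
    (x + y) ^ suc k                            ≈⟨ Binomial.theorem (*-comm x y) (suc k) ⟩
    Sum.sum {suc (suc k)} (λ i → term (toℕ i))   ≈⟨ +-congˡ (Sum.sum-init-last {k} (λ i → term (suc (toℕ i)))) ⟩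
    term 0 + (Sum.sum {k} (λ i → term (suc (toℕ (Fin.inject₁ i)))) + term (suc (toℕ (Fin.fromℕ k))))
      ≈⟨ +-cong first (+-cong (Sum.sum-cong-≋ middle) (reflexive (≡.cong (λ j → term (suc j)) (toℕ-fromℕ k)))) ⟩
    pow y (suc k) + (Sum.sum {k} (λ _ → 0#) + term (suc k)) ≈⟨ +-congˡ (+-cong (Sum.sum-replicate-zero k) last) ⟩
    pow y (suc k) + (0# + pow x (suc k))       ≈⟨ trans (+-congˡ (+-identityˡ _)) (+-comm _ _) ⟩
    pow x (suc k) + pow y (suc k)              ∎
    where
    module Sum = CommutativeMonoidSum +-commutativeMonoid
    module Binomial = Algebra.Properties.Semiring.Binomial semiring x y
    open import Algebra.Properties.Semiring.Mult semiring using () renaming (_×_ to _×ₛ_)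
    open import Algebra.Properties.Semiring.Exp semiring using (_^_)
    ×ₛ≈· : ∀ k z → k ×ₛ z ≈ k · z
    ×ₛ≈· zero z = refl
    ×ₛ≈· (suc k) z = +-congˡ (×ₛ≈· k z)
    pow≈^ : ∀ x k → pow x k ≈ x ^ k
    pow≈^ x zero = refl
    pow≈^ x (suc k) = *-congˡ (pow≈^ x k)
    term : ℕ → Carrier
    term j = (suc k C j) ×ₛ (x ^ j * y ^ (suc k ∸ j))
    first : term 0 ≈ pow y (suc k)
    first = trans (+-identityʳ _) (trans (*-identityˡ _) (sym (pow≈^ y (suc k))))
    last : term (suc k) ≈ pow x (suc k)
    last = begin
      (suc k C suc k) ×ₛ (x ^ suc k * y ^ (suc k ∸ suc k)) ≡⟨ ≡.cong (λ c → c ×ₛ (x ^ suc k * y ^ (suc k ∸ suc k))) (nCn≡1 (suc k)) ⟩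
      1 ×ₛ (x ^ suc k * y ^ (k ∸ k))                       ≡⟨ ≡.cong (λ j → 1 ×ₛ (x ^ suc k * y ^ j)) (ℕₚ.n∸n≡0 k) ⟩
      (x ^ suc k * 1#) + 0#                                ≈⟨ trans (+-identityʳ _) (*-identityʳ _) ⟩
      x ^ suc k                                            ≈⟨ sym (pow≈^ x (suc k)) ⟩
      pow x (suc k)                                        ∎
    middle : ∀ (i : Fin k) → term (suc (toℕ (Fin.inject₁ i))) ≈ 0#
    middle i = trans (×ₛ≈· (suc k C j) _) (∣⇒·≈0 q·1#≈0 (suc k C j) _ (prime∣binomial pr j (s≤s z≤n) j<q))
      where
      j = suc (toℕ (Fin.inject₁ i))
      j<q = s≤s (≡.subst (_< k) (≡.sym (toℕ-inject₁ i)) (toℕ<n i))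

  module Frobenius (pr : Prime p) (p·1#≈0 : p · 1# ≈ 0#) where
    1≤p^ : ∀ k → 1 ≤ p ℕ.^ k
    1≤p^ k = ℕₚ.m^n>0 p {{ℕ.>-nonZero (ℕₚ.≤-trans (s≤s z≤n) (prime⇒2≤ pr))}} k

    σ : ℕ → Carrier → Carrier
    σ k x = pow x (p ℕ.^ k)

    σ-cong : ∀ k {x y} → x ≈ y → σ k x ≈ σ k y
    σ-cong k = pow-cong (p ℕ.^ k)

    σ-+ : ∀ k x y → σ k (x + y) ≈ σ k x + σ k y
    σ-+ zero x y = trans (*-identityʳ _) (sym (+-cong (*-identityʳ x) (*-identityʳ y)))
    σ-+ (suc k) x y = begin
      pow (x + y) (p ℕ.* p ℕ.^ k)                ≈⟨ pow-* (x + y) p (p ℕ.^ k) ⟩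
      σ k (pow (x + y) p)                        ≈⟨ σ-cong k (pow-+-prime p pr p·1#≈0 x y) ⟩
      σ k (pow x p + pow y p)                    ≈⟨ σ-+ k _ _ ⟩
      σ k (pow x p) + σ k (pow y p)              ≈⟨ sym (+-cong (pow-* x p (p ℕ.^ k)) (pow-* y p (p ℕ.^ k))) ⟩
      σ (suc k) x + σ (suc k) y                  ∎

    σ-* : ∀ k x y → σ k (x * y) ≈ σ k x * σ k y
    σ-* k x y = pow-distrib-* x y (p ℕ.^ k)

    σ-0# : ∀ k → σ k 0# ≈ 0#
    σ-0# k = pow-0# (p ℕ.^ k) (1≤p^ k)

    σ-1# : ∀ k → σ k 1# ≈ 1#
    σ-1# k = pow-1# (p ℕ.^ k)

    σ-‿ : ∀ k x → σ k (- x) ≈ - σ k x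
    σ-‿ k x = -‿unique (σ k x) (σ k (- x)) (trans (sym (σ-+ k x (- x))) (trans (σ-cong k (-‿inverseʳ x)) (σ-0# k)))

    σ-·1# : ∀ k j → σ k (j · 1#) ≈ j · 1#
    σ-·1# k zero = σ-0# k
    σ-·1# k (suc j) = trans (σ-+ k 1# (j · 1#)) (+-cong (σ-1# k) (σ-·1# k j))

    σ-· : ∀ k j x → σ k (j · x) ≈ j · σ k x
    σ-· k j x = begin
      σ k (j · x)              ≈⟨ σ-cong k (·≈·1#* j x) ⟩
      σ k ((j · 1#) * x)       ≈⟨ σ-* k _ x ⟩
      σ k (j · 1#) * σ k x     ≈⟨ *-congʳ (σ-·1# k j) ⟩
      (j · 1#) * σ k x         ≈⟨ sym (·≈·1#* j (σ k x)) ⟩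
      j · σ k x                ∎

    σ-∘ : ∀ a b x → σ a (σ b x) ≈ σ (b ℕ.+ a) x
    σ-∘ a b x = trans (sym (pow-* x (p ℕ.^ b) (p ℕ.^ a))) (reflexive (≡.cong (pow x) (≡.sym (ℕₚ.^-distribˡ-+-* p b a))))

    σ-pow : ∀ k x j → σ k (pow x j) ≈ pow (σ k x) j
    σ-pow k x j = pow-comm x j (p ℕ.^ k)

    σ-inv : ∀ k x → ¬ (x ≈ 0#) → σ k (inv x) ≈ inv (σ k x)
    σ-inv k x x≉0 = pow-inv x (p ℕ.^ k) x≉0

    σ-Σ< : ∀ k j g → σ k (Σ< j g) ≈ Σ< j (λ i → σ k (g i))
    σ-Σ< k zero g = σ-0# k
    σ-Σ< k (suc j) g = trans (σ-+ k _ _) (+-congʳ (σ-Σ< k j g))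

    σ-zero : ∀ x → σ 0 x ≈ x
    σ-zero x = *-identityʳ x

module FieldOfSize (R : CommutativeRing 0ℓ 0ℓ) (inv : CommutativeRing.Carrier R → CommutativeRing.Carrier R)
                   (x*inv≈1 : InverseOnNonzero R inv) (p m n r : ℕ) (pr : Prime p) (1≤m : m ≥ 1) (1≤n : n ≥ 1) (1≤r : r ≥ 1)
                   (hs : Setup.HasSize R inv p m n r (p ℕ.^ (m ℕ.* n))) where
  open CommutativeRing R

  2≤p : 2 ≤ p
  2≤p = prime⇒2≤ pr

  1≤mn : 1 ≤ m ℕ.* n
  1≤mn = ℕₚ.*-mono-≤ 1≤m 1≤n

  2≤size : 2 ≤ p ℕ.^ (m ℕ.* n)
  2≤size = 2≤^ p (m ℕ.* n) 2≤p 1≤mn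

  1≉0 : Nontrivial R
  1≉0 = HasSize⇒Nontrivial R inv p m n r _ 2≤size hs

  open Field R inv x*inv≈1 1≉0 p m n r public

  size≡suc : p ℕ.^ (m ℕ.* n) ≡ suc (ℕ.pred (p ℕ.^ (m ℕ.* n)))
  size≡suc = ≡.sym (ℕₚ.suc-pred _ {{ℕ.>-nonZero (ℕₚ.≤-trans (s≤s z≤n) 2≤size)}})

  open FiniteField (ℕ.pred (p ℕ.^ (m ℕ.* n))) (≡.subst HasSize size≡suc hs) public using (_≟_; fermat; size·≈0)

  -- (p·1)^(mn) = p^(mn)·1 = 0, and a field has no nilpotents.
  p·1#≈0 : p · 1# ≈ 0#
  p·1#≈0 with (p · 1#) ≟ 0#
  ... | yes p·1#≈0 = p·1#≈0
  ... | no p·1#≉0 = ⊥-elim (pow-≉0 (p · 1#) (m ℕ.* n) p·1#≉0 (begin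
    pow (p · 1#) (m ℕ.* n)              ≈⟨ pow-·1# p (m ℕ.* n) ⟩
    (p ℕ.^ (m ℕ.* n)) · 1#              ≡⟨ ≡.cong (_· 1#) size≡suc ⟩
    suc (ℕ.pred (p ℕ.^ (m ℕ.* n))) · 1# ≈⟨ size·≈0 1# ⟩
    0#                                  ∎))

  open Frobenius pr p·1#≈0 public

  σ-mn : ∀ x → σ (m ℕ.* n) x ≈ x
  σ-mn x = trans (reflexive (≡.cong (pow x) size≡suc)) (fermat x)

  σ-*mn : ∀ k x → σ (k ℕ.* (m ℕ.* n)) x ≈ x
  σ-*mn zero x = σ-zero x
  σ-*mn (suc k) x = trans (sym (σ-∘ (k ℕ.* (m ℕ.* n)) (m ℕ.* n) x)) (trans (σ-cong (k ℕ.* (m ℕ.* n)) (σ-mn x)) (σ-*mn k x))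

  σ-*m : ∀ {x} → InFq x → ∀ k → σ (k ℕ.* m) x ≈ x
  σ-*m x∈Fq zero = σ-zero _
  σ-*m {x} x∈Fq (suc k) = trans (sym (σ-∘ (k ℕ.* m) m x)) (trans (σ-cong (k ℕ.* m) x∈Fq) (σ-*m x∈Fq k))

  σ-*m+ : ∀ {x} → InFq x → ∀ k a → σ (k ℕ.* m ℕ.+ a) x ≈ σ a x
  σ-*m+ {x} x∈Fq k a = trans (sym (σ-∘ a (k ℕ.* m) x)) (σ-cong a (σ-*m x∈Fq k))

  Fq-+ : ∀ {x y} → InFq x → InFq y → InFq (x + y)
  Fq-+ x∈Fq y∈Fq = trans (σ-+ m _ _) (+-cong x∈Fq y∈Fq)

  Fq-* : ∀ {x y} → InFq x → InFq y → InFq (x * y)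
  Fq-* x∈Fq y∈Fq = trans (σ-* m _ _) (*-cong x∈Fq y∈Fq)

  Fq-- : ∀ {x y} → InFq x → InFq y → InFq (x - y)
  Fq-- x∈Fq y∈Fq = Fq-+ x∈Fq (trans (σ-‿ m _) (-‿cong y∈Fq))

  Fq-0# : InFq 0#
  Fq-0# = σ-0# m

  Fq-·1# : ∀ j → InFq (j · 1#)
  Fq-·1# j = σ-·1# m j

  Fq-inv : ∀ {x} → ¬ (x ≈ 0#) → InFq x → InFq (inv x)
  Fq-inv {x} x≉0 x∈Fq = trans (σ-inv m x x≉0) (inv-cong (λ σx≈0 → x≉0 (trans (sym x∈Fq) σx≈0)) x∈Fq)

  Fq-pow : ∀ {x} k → InFq x → InFq (pow x k)
  Fq-pow {x} k x∈Fq = trans (σ-pow m x k) (pow-cong k x∈Fq)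

  eval-cong : ∀ P {x y} → x ≈ y → eval P x ≈ eval P y
  eval-cong [] x≈y = refl
  eval-cong (c ∷ P) x≈y = +-congˡ (*-cong x≈y (eval-cong P x≈y))

  Fq-eval : ∀ {P y} → All InFq P → InFq y → InFq (eval P y)
  Fq-eval [] y∈Fq = Fq-0#
  Fq-eval (c∈Fq ∷ P∈Fq) y∈Fq = Fq-+ c∈Fq (Fq-* y∈Fq (Fq-eval P∈Fq y∈Fq))

  Σ<≡big : ∀ k g → Σ< k g ≡ Add.big k g
  Σ<≡big zero g = ≡.refl
  Σ<≡big (suc k) g = ≡.cong (_+ g k) (Σ<≡big k g)

  Σ<-cong : ∀ k {g h : ℕ → Carrier} → (∀ i → i < k → g i ≈ h i) → Σ< k g ≈ Σ< k h
  Σ<-cong k {g} {h} eq = trans (reflexive (Σ<≡big k g)) (trans (Add.big-cong k eq) (reflexive (≡.sym (Σ<≡big k h))))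

  Σ<-+ : ∀ k (g h : ℕ → Carrier) → Σ< k (λ i → g i + h i) ≈ Σ< k g + Σ< k h
  Σ<-+ k g h = trans (reflexive (Σ<≡big k _)) (trans (Add.big-∙ k g h) (sym (+-cong (reflexive (Σ<≡big k g)) (reflexive (Σ<≡big k h)))))

  *-Σ< : ∀ k c (g : ℕ → Carrier) → c * Σ< k g ≈ Σ< k (λ i → c * g i)
  *-Σ< zero c g = zeroʳ c
  *-Σ< (suc k) c g = trans (distribˡ c _ _) (+-congʳ (*-Σ< k c g))

  Σ<-‿ : ∀ k (g : ℕ → Carrier) → Σ< k (λ i → - g i) ≈ - Σ< k g
  Σ<-‿ zero g = sym -0#≈0#
  Σ<-‿ (suc k) g = trans (+-congʳ (Σ<-‿ k g)) (-x+-y≈-[x+y] _ _)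

  Σ<-0# : ∀ k → Σ< k (λ _ → 0#) ≈ 0#
  Σ<-0# k = trans (reflexive (Σ<≡big k _)) (Add.big-ε k)

  Σ<-rotate : ∀ k (g : ℕ → Carrier) → g k ≈ g 0 → Σ< k (λ i → g (suc i)) ≈ Σ< k g
  Σ<-rotate k g gk≈g0 = +-cancelʳ (g k) _ _ (begin
    Σ< k (λ i → g (suc i)) + g k         ≈⟨ +-congˡ gk≈g0 ⟩
    Σ< k (λ i → g (suc i)) + g 0         ≈⟨ +-comm _ _ ⟩
    g 0 + Σ< k (λ i → g (suc i))         ≡⟨ ≡.cong (g 0 +_) (Σ<≡big k _) ⟩
    g 0 + Add.big k (λ i → g (suc i))    ≈⟨ sym (Add.big-suc-head k g) ⟩
    Add.big (suc k) g                    ≡⟨ ≡.sym (Σ<≡big (suc k) g) ⟩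
    Σ< (suc k) g                         ∎)

  Σ<-weighted-shift : ∀ N (g : ℕ → Carrier) →
    Σ< N (λ j → suc j · g (suc j)) + Σ< (suc N) g ≈ Σ< N (λ j → suc j · g j) + suc N · g N
  Σ<-weighted-shift zero g = trans (+-identityˡ _) (trans (+-identityˡ _) (sym (trans (+-identityˡ _) (+-identityʳ _))))
  Σ<-weighted-shift (suc N) g = trans (+-interchange _ _ _ _) (+-cong (Σ<-weighted-shift N g) (+-comm _ _))

  pow-q^ : ∀ x i → pow x (q ℕ.^ i) ≈ σ (i ℕ.* m) x
  pow-q^ x i = reflexive (≡.cong (pow x) (≡.trans (ℕₚ.^-*-assoc p m i) (≡.cong (p ℕ.^_) (ℕₚ.*-comm m i))))

  T-cong : ∀ {x y} → x ≈ y → T x ≈ T y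
  T-cong x≈y = Σ<-cong n (λ i _ → pow-cong (q ℕ.^ i) x≈y)

  T-+ : ∀ x y → T (x + y) ≈ T x + T y
  T-+ x y = trans (Σ<-cong n (λ i _ → trans (pow-q^ _ i) (trans (σ-+ (i ℕ.* m) x y) (sym (+-cong (pow-q^ x i) (pow-q^ y i))))))
                  (Σ<-+ n _ _)

  T-‿ : ∀ x → T (- x) ≈ - T x
  T-‿ x = trans (Σ<-cong n (λ i _ → trans (pow-q^ _ i) (trans (σ-‿ (i ℕ.* m) x) (-‿cong (sym (pow-q^ x i)))))) (Σ<-‿ n _)

  T-- : ∀ x y → T (x - y) ≈ T x - T y
  T-- x y = trans (T-+ x (- y)) (+-congˡ (T-‿ y))

  T-*ˡ : ∀ {c} x → InFq c → T (c * x) ≈ c * T x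
  T-*ˡ {c} x c∈Fq = trans (Σ<-cong n (λ i _ → trans (pow-distrib-* c x (q ℕ.^ i)) (*-congʳ (trans (pow-q^ c i) (σ-*m c∈Fq i)))))
                          (sym (*-Σ< n c _))

  T-σ : ∀ k x → T (σ k x) ≈ σ k (T x)
  T-σ k x = trans (Σ<-cong n (λ i _ → pow-comm x (p ℕ.^ k) (q ℕ.^ i))) (sym (σ-Σ< k n _))

  T-· : ∀ k x → T (k · x) ≈ k · T x
  T-· k x = trans (T-cong (·≈·1#* k x)) (trans (T-*ˡ x (Fq-·1# k)) (sym (·≈·1#* k (T x))))

  -- σ_m permutes the n summands of T x cyclically.
  Fq-T : ∀ x → InFq (T x)
  Fq-T x = begin
    σ m (T x)                        ≈⟨ σ-Σ< m n _ ⟩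
    Σ< n (λ i → σ m (pow x (q ℕ.^ i))) ≈⟨ Σ<-cong n (λ i _ → trans (σ-cong m (pow-q^ x i))
                                          (trans (σ-∘ m (i ℕ.* m) x) (reflexive (≡.cong (λ k → σ k x) (ℕₚ.+-comm (i ℕ.* m) m))))) ⟩
    Σ< n (λ i → σ (suc i ℕ.* m) x)   ≈⟨ Σ<-rotate n (λ i → σ (i ℕ.* m) x)
                                          (trans (reflexive (≡.cong (λ k → σ k x) (ℕₚ.*-comm n m))) (trans (σ-mn x) (sym (σ-zero x)))) ⟩
    Σ< n (λ i → σ (i ℕ.* m) x)       ≈⟨ Σ<-cong n (λ i _ → sym (pow-q^ x i)) ⟩
    T x                              ∎

  T-Fq : ∀ {c} → InFq c → T c ≈ n · c
  T-Fq {c} c∈Fq = trans (Σ<-cong n (λ i _ → trans (pow-q^ c i) (σ-*m c∈Fq i))) (trans (reflexive (Σ<≡big n _)) (Add-big-const n c))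

  T-Σ< : ∀ k g → T (Σ< k g) ≈ Σ< k (λ j → T (g j))
  T-Σ< zero g = trans (T-Fq Fq-0#) (·-0# n)
  T-Σ< (suc k) g = trans (T-+ _ _) (+-congʳ (T-Σ< k g))

  coprime⇒·1#≉0 : ∀ j → Coprime j p → ¬ (j · 1# ≈ 0#)
  coprime⇒·1#≉0 j coprime j·1#≈0 with coprime-Bézout coprime
  ... | Bézout.+- x y eq = 1≉0 (begin
    1#                          ≈⟨ sym (+-identityʳ 1#) ⟩
    1# + 0#                     ≈⟨ +-congˡ (sym (trans (*-congˡ p·1#≈0) (zeroʳ _))) ⟩
    1# + (y · 1#) * (p · 1#)    ≈⟨ +-congˡ (sym (·1#-homo-* y p)) ⟩
    (1 ℕ.+ y ℕ.* p) · 1#        ≡⟨ ≡.cong (_· 1#) eq ⟩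
    (x ℕ.* j) · 1#              ≈⟨ ·1#-homo-* x j ⟩
    (x · 1#) * (j · 1#)         ≈⟨ trans (*-congˡ j·1#≈0) (zeroʳ _) ⟩
    0#                          ∎)
  ... | Bézout.-+ x y eq = 1≉0 (begin
    1#                          ≈⟨ sym (+-identityʳ 1#) ⟩
    1# + 0#                     ≈⟨ +-congˡ (sym (trans (*-congˡ j·1#≈0) (zeroʳ _))) ⟩
    1# + (x · 1#) * (j · 1#)    ≈⟨ +-congˡ (sym (·1#-homo-* x j)) ⟩
    (1 ℕ.+ x ℕ.* j) · 1#        ≡⟨ ≡.cong (_· 1#) eq ⟩
    (y ℕ.* p) · 1#              ≈⟨ ·1#-homo-* y p ⟩
    (y · 1#) * (p · 1#)         ≈⟨ trans (*-congˡ p·1#≈0) (zeroʳ _) ⟩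
    0#                          ∎)

  pʳ : ℕ
  pʳ = p ℕ.^ r

  2≤pʳ : 2 ≤ pʳ
  2≤pʳ = 2≤^ p r 2≤p 1≤r

  pow-pʳ : ∀ y → pow y pʳ ≈ y * pow y (pʳ ∸ 1)
  pow-pʳ y = reflexive (≡.cong (pow y) (≡.sym (ℕₚ.m+[n∸m]≡n {1} {pʳ} (ℕₚ.≤-trans (s≤s z≤n) 2≤pʳ))))

  pow-pʳ^ : ∀ x k → pow x (pʳ ℕ.^ k) ≈ σ (k ℕ.* r) x
  pow-pʳ^ x k = reflexive (≡.cong (pow x) (≡.trans (ℕₚ.^-*-assoc p r k) (≡.cong (p ℕ.^_) (ℕₚ.*-comm r k))))

  pow-geom : ∀ x B k → pow x (geom B k) ≈ Mul.big k (λ i → pow x (B ℕ.^ i))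
  pow-geom x B zero = refl
  pow-geom x B (suc k) = trans (reflexive (≡.cong (pow x) (geom-suc B k))) (trans (pow-+ x (geom B k) (B ℕ.^ k)) (*-congʳ (pow-geom x B k)))

  -- Iterating σ_r(v) = c v + y k times, the factors σ_{ir}(c) multiply to c^(geom pʳ k).
  telescope : ∀ c v y → ¬ (c ≈ 0#) → σ r v ≈ c * v + y → ∀ k →
              pow (inv c) (geom pʳ k) * σ (k ℕ.* r) v ≈ v + Σ< k (λ i → pow (inv c) (geom pʳ (suc i)) * σ (i ℕ.* r) y)
  telescope c v y c≉0 σv≈ zero = trans (*-identityˡ _) (trans (σ-zero v) (sym (+-identityʳ v)))
  telescope c v y c≉0 σv≈ (suc k) = begin
    Dₖ₊₁ * σ (r ℕ.+ k ℕ.* r) v                              ≈⟨ *-congˡ (sym (σ-∘ (k ℕ.* r) r v)) ⟩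
    Dₖ₊₁ * σ (k ℕ.* r) (σ r v)                              ≈⟨ *-congˡ (σ-cong (k ℕ.* r) σv≈) ⟩
    Dₖ₊₁ * σ (k ℕ.* r) (c * v + y)                          ≈⟨ *-congˡ (trans (σ-+ (k ℕ.* r) (c * v) y) (+-congʳ (σ-* (k ℕ.* r) c v))) ⟩
    Dₖ₊₁ * (σ (k ℕ.* r) c * σ (k ℕ.* r) v + σ (k ℕ.* r) y)  ≈⟨ distribˡ _ _ _ ⟩
    Dₖ₊₁ * (σ (k ℕ.* r) c * σ (k ℕ.* r) v) + Dₖ₊₁ * σ (k ℕ.* r) y ≈⟨ +-congʳ cancel ⟩
    pow (inv c) (geom pʳ k) * σ (k ℕ.* r) v + Dₖ₊₁ * σ (k ℕ.* r) y ≈⟨ +-congʳ (telescope c v y c≉0 σv≈ k) ⟩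
    (v + Σ< k _) + Dₖ₊₁ * σ (k ℕ.* r) y                    ≈⟨ +-assoc _ _ _ ⟩
    v + Σ< (suc k) (λ i → pow (inv c) (geom pʳ (suc i)) * σ (i ℕ.* r) y) ∎
    where
    Dₖ₊₁ = pow (inv c) (geom pʳ (suc k))
    invσc*σc≈1 : pow (inv c) (pʳ ℕ.^ k) * σ (k ℕ.* r) c ≈ 1#
    invσc*σc≈1 = trans (*-congʳ (pow-pʳ^ (inv c) k))
      (trans (sym (σ-* (k ℕ.* r) (inv c) c)) (trans (σ-cong (k ℕ.* r) (inv*x≈1 c c≉0)) (σ-1# (k ℕ.* r))))
    cancel : Dₖ₊₁ * (σ (k ℕ.* r) c * σ (k ℕ.* r) v) ≈ pow (inv c) (geom pʳ k) * σ (k ℕ.* r) v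
    cancel = begin
      Dₖ₊₁ * (σ (k ℕ.* r) c * σ (k ℕ.* r) v)                                         ≈⟨ *-congʳ (trans (reflexive (≡.cong (pow (inv c)) (geom-suc pʳ k))) (pow-+ (inv c) (geom pʳ k) (pʳ ℕ.^ k))) ⟩
      (pow (inv c) (geom pʳ k) * pow (inv c) (pʳ ℕ.^ k)) * (σ (k ℕ.* r) c * σ (k ℕ.* r) v) ≈⟨ trans (*-assoc _ _ _) (*-congˡ (sym (*-assoc _ _ _))) ⟩
      pow (inv c) (geom pʳ k) * ((pow (inv c) (pʳ ℕ.^ k) * σ (k ℕ.* r) c) * σ (k ℕ.* r) v) ≈⟨ *-congˡ (trans (*-congʳ invσc*σc≈1) (*-identityˡ _)) ⟩
      pow (inv c) (geom pʳ k) * σ (k ℕ.* r) v                                         ∎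

  module Reduction (p∤n : ¬ (p ∣ n)) (G : Poly) (G∈Fq : All InFq G)
                   (a : Carrier) (a∈Fq : InFq a) (a≉0 : ¬ (a ≈ 0#))
                   (f-permutation : PermOn (λ _ → ⊤) (WithG.f G a)) where
    open WithG G a public

    a⁻¹∈Fq : InFq (inv a)
    a⁻¹∈Fq = Fq-inv a≉0 a∈Fq

    f-injective : ∀ x y → f x ≈ f y → x ≈ y
    f-injective x y = proj₁ (proj₂ f-permutation) x y tt tt

    f-surjective : ∀ y → ∃ λ x → f x ≈ y
    f-surjective y with proj₂ (proj₂ f-permutation) y tt
    ... | x , _ , fx≈y = x , fx≈y

    -- f x = φ (T x) x, and φ y x = a σ_r(x) + x K(y).
    K : Carrier → Carrier
    K y = eval G y - a * pow y (pʳ ∸ 1)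

    K-cong : ∀ {y y′} → y ≈ y′ → K y ≈ K y′
    K-cong y≈y′ = +-cong (eval-cong G y≈y′) (-‿cong (*-congˡ (pow-cong (pʳ ∸ 1) y≈y′)))

    Fq-K : ∀ {y} → InFq y → InFq (K y)
    Fq-K y∈Fq = Fq-- (Fq-eval G∈Fq y∈Fq) (Fq-* a∈Fq (Fq-pow (pʳ ∸ 1) y∈Fq))

    φ-cong : ∀ {y y′ x x′} → y ≈ y′ → x ≈ x′ → φ y x ≈ φ y′ x′
    φ-cong y≈y′ x≈x′ = +-cong (*-congˡ (σ-cong r x≈x′)) (*-cong x≈x′ (K-cong y≈y′))

    f-cong : ∀ {x x′} → x ≈ x′ → f x ≈ f x′
    f-cong x≈x′ = φ-cong (T-cong x≈x′) x≈x′

    φ-diagonal : ∀ y → φ y y ≈ fbar y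
    φ-diagonal y = begin
      a * pow y pʳ + y * (eval G y - a * pow y (pʳ ∸ 1))     ≈⟨ +-congˡ (trans (distribˡ y _ _) (+-congˡ (sym (-‿distribʳ-* y _)))) ⟩
      a * pow y pʳ + (y * eval G y - y * (a * pow y (pʳ ∸ 1))) ≈⟨ +-congˡ (+-congˡ (-‿cong (trans (x*yz≈y*xz y a _) (*-congˡ (sym (pow-pʳ y)))))) ⟩
      a * pow y pʳ + (y * eval G y - a * pow y pʳ)           ≈⟨ x+[y-x]≈y _ _ ⟩
      fbar y                                                 ∎

    T-φ : ∀ {y} x → InFq y → T (φ y x) ≈ φ y (T x)
    T-φ {y} x y∈Fq = begin
      T (a * σ r x + x * K y)        ≈⟨ T-+ _ _ ⟩
      T (a * σ r x) + T (x * K y)    ≈⟨ +-cong (T-*ˡ _ a∈Fq) (trans (T-cong (*-comm x _)) (T-*ˡ x (Fq-K y∈Fq))) ⟩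
      a * T (σ r x) + K y * T x      ≈⟨ +-cong (*-congˡ (T-σ r x)) (*-comm _ _) ⟩
      a * σ r (T x) + T x * K y      ∎

    T-f : ∀ x → T (f x) ≈ fbar (T x)
    T-f x = trans (T-φ x (Fq-T x)) (φ-diagonal (T x))

    φ-+ : ∀ y x x′ → φ y (x + x′) ≈ φ y x + φ y x′
    φ-+ y x x′ = trans (+-cong (trans (*-congˡ (σ-+ r x x′)) (distribˡ a _ _)) (distribʳ (K y) x x′)) (+-interchange _ _ _ _)

    φ-- : ∀ y x x′ → φ y (x - x′) ≈ φ y x - φ y x′
    φ-- y x x′ = trans (φ-+ y x (- x′)) (+-congˡ (begin
      a * σ r (- x′) + - x′ * K y        ≈⟨ +-cong (trans (*-congˡ (σ-‿ r x′)) (sym (-‿distribʳ-* a _))) (sym (-‿distribˡ-* x′ _)) ⟩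
      - (a * σ r x′) + - (x′ * K y)      ≈⟨ -x+-y≈-[x+y] _ _ ⟩
      - φ y x′                           ∎))

    φ-0# : ∀ y → φ y 0# ≈ 0#
    φ-0# y = trans (+-cong (trans (*-congˡ (σ-0# r)) (zeroʳ a)) (zeroˡ _)) (+-identityˡ 0#)

    n·1#≉0 : ¬ (n · 1# ≈ 0#)
    n·1#≉0 = coprime⇒·1#≉0 n λ (i∣n , i∣p) → case prime⇒irreducible pr i∣p of λ where
      (inj₁ i≡1) → i≡1
      (inj₂ ≡.refl) → ⊥-elim (p∤n i∣n)

    1/n : Carrier
    1/n = inv (n · 1#)

    1/n≉0 : ¬ (1/n ≈ 0#)
    1/n≉0 = inv-≉0 _ n·1#≉0

    σ-1/n : ∀ k → σ k 1/n ≈ 1/n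
    σ-1/n k = trans (σ-inv k _ n·1#≉0) (inv-cong (λ eq → n·1#≉0 (trans (sym (σ-·1# k n)) eq)) (σ-·1# k n))

    1/n*[n·] : ∀ u → 1/n * (n · u) ≈ u
    1/n*[n·] u = trans (*-congˡ (·≈·1#* n u)) (inv-cancelˡ (n · 1#) u n·1#≉0)

    n·[1/n*] : ∀ u → n · (1/n * u) ≈ u
    n·[1/n*] u = trans (·≈·1#* n _) (inv-cancelʳ (n · 1#) u n·1#≉0)

    T-1/n* : ∀ {u} → InFq u → T (1/n * u) ≈ u
    T-1/n* u∈Fq = trans (T-Fq (Fq-* (σ-1/n m) u∈Fq)) (n·[1/n*] _)

    f-1/n* : ∀ u → InFq u → f (1/n * u) ≈ 1/n * fbar u
    f-1/n* u u∈Fq = begin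
      f (1/n * u)                                 ≈⟨ φ-cong (T-1/n* u∈Fq) refl ⟩
      a * σ r (1/n * u) + (1/n * u) * K u         ≈⟨ +-cong (*-congˡ (trans (σ-* r 1/n u) (*-congʳ (σ-1/n r)))) (*-assoc _ _ _) ⟩
      a * (1/n * σ r u) + 1/n * (u * K u)         ≈⟨ +-congʳ (x*yz≈y*xz a 1/n _) ⟩
      1/n * (a * σ r u) + 1/n * (u * K u)         ≈⟨ sym (distribˡ 1/n _ _) ⟩
      1/n * φ u u                                 ≈⟨ *-congˡ (φ-diagonal u) ⟩
      1/n * fbar u                                ∎

    fbar-injective : ∀ u v → InFq u → InFq v → fbar u ≈ fbar v → u ≈ v
    fbar-injective u v u∈Fq v∈Fq fbar-u≈fbar-v = *-cancelˡ 1/n u v 1/n≉0 (f-injective _ _ (begin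
      f (1/n * u)    ≈⟨ f-1/n* u u∈Fq ⟩
      1/n * fbar u   ≈⟨ *-congˡ fbar-u≈fbar-v ⟩
      1/n * fbar v   ≈⟨ sym (f-1/n* v v∈Fq) ⟩
      f (1/n * v)    ∎))

    fbar-permutation : PermOn InFq fbar
    fbar-permutation = (λ u u∈Fq → Fq-* u∈Fq (Fq-eval G∈Fq u∈Fq)) , fbar-injective , surjective
      where
      surjective : ∀ y → InFq y → ∃ λ u → InFq u × fbar u ≈ y
      surjective y y∈Fq with f-surjective (1/n * y)
      ... | w , fw≈y/n = T w , Fq-T w , trans (sym (T-f w)) (trans (T-cong fw≈y/n) (T-1/n* y∈Fq))

    -- φ y is the restriction of f to the fibre T⁻¹(y), translated to ker T by z₀ = y/n.
    φ-permutation : ∀ y → InFq y → PermOn (λ x → T x ≈ 0#) (φ y)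
    φ-permutation y y∈Fq = maps , injective , surjective
      where
      z₀ = 1/n * y
      T-z₀ : T z₀ ≈ y
      T-z₀ = T-1/n* y∈Fq
      maps : ∀ x → T x ≈ 0# → T (φ y x) ≈ 0#
      maps x Tx≈0 = trans (T-φ x y∈Fq) (trans (φ-cong refl Tx≈0) (φ-0# y))
      f-z₀+ : ∀ x → T x ≈ 0# → f (z₀ + x) ≈ φ y z₀ + φ y x
      f-z₀+ x Tx≈0 = trans (φ-cong (trans (T-+ z₀ x) (trans (+-cong T-z₀ Tx≈0) (+-identityʳ y))) refl) (φ-+ y z₀ x)
      injective : ∀ x x′ → T x ≈ 0# → T x′ ≈ 0# → φ y x ≈ φ y x′ → x ≈ x′
      injective x x′ Tx≈0 Tx′≈0 φx≈φx′ = +-cancelʳ z₀ x x′ (trans (+-comm x z₀) (trans (f-injective _ _ (begin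
        f (z₀ + x)            ≈⟨ f-z₀+ x Tx≈0 ⟩
        φ y z₀ + φ y x        ≈⟨ +-congˡ φx≈φx′ ⟩
        φ y z₀ + φ y x′       ≈⟨ sym (f-z₀+ x′ Tx′≈0) ⟩
        f (z₀ + x′)           ∎)) (+-comm z₀ x′)))
      surjective : ∀ u → T u ≈ 0# → ∃ λ x → T x ≈ 0# × φ y x ≈ u
      surjective u Tu≈0 with f-surjective (φ y z₀ + u)
      ... | w , fw≈ = w - z₀ , trans (T-- w z₀) (trans (+-cong Tw≈y (-‿cong T-z₀)) (-‿inverseʳ y)) , (begin
        φ y (w - z₀)             ≈⟨ φ-- y w z₀ ⟩
        φ y w - φ y z₀           ≈⟨ +-congʳ (trans (φ-cong (sym Tw≈y) refl) fw≈) ⟩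
        (φ y z₀ + u) - φ y z₀    ≈⟨ [x+y]-x≈y _ _ ⟩
        u                        ∎)
        where
        Tw≈y : T w ≈ y
        Tw≈y = fbar-injective (T w) y (Fq-T w) y∈Fq (begin
          fbar (T w)           ≈⟨ sym (T-f w) ⟩
          T (f w)              ≈⟨ T-cong fw≈ ⟩
          T (φ y z₀ + u)       ≈⟨ T-+ _ _ ⟩
          T (φ y z₀) + T u     ≈⟨ +-cong (T-φ z₀ y∈Fq) Tu≈0 ⟩
          φ y (T z₀) + 0#      ≈⟨ trans (+-identityʳ _) (φ-cong refl T-z₀) ⟩
          φ y y                ≈⟨ φ-diagonal y ⟩
          fbar y               ∎)

    module Preimage (d≡gcd[mn,r] : gcd m r ≡ gcd (m ℕ.* n) r) (gcd[n,pᵈ-1]≡1 : gcd n (p ℕ.^ gcd m r ∸ 1) ≡ 1) where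
      open GcdQuotients (gcdQuotients m n r 1≤m d≡gcd[mn,r])

      1≤t : 1 ≤ t
      1≤t = ℕₚ.n≢0⇒n>0 λ t≡0 → ℕₚ.<⇒≱ 1≤m (ℕₚ.≤-reflexive (≡.trans m≡t*d (≡.cong (ℕ._* d) t≡0)))

      instance
        t≢0 : NonZero t
        t≢0 = ℕ.>-nonZero 1≤t

      pᵈ : ℕ
      pᵈ = p ℕ.^ d

      q≡pᵈ^t : q ≡ pᵈ ℕ.^ t
      q≡pᵈ^t = ≡.trans (≡.cong (p ℕ.^_) (≡.trans m≡t*d (ℕₚ.*-comm t d))) (≡.sym (ℕₚ.^-*-assoc p d t))

      Nrm≡pow-geom : ∀ c → Nrm c ≡ pow c (geom pᵈ t)
      Nrm≡pow-geom c = ≡.cong (pow c) (≡.trans (≡.cong (λ k → divN (k ∸ 1) (pᵈ ∸ 1)) q≡pᵈ^t) (divN-geom pᵈ t (2≤^ p d 2≤p 1≤d)))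

      e≡geom : ∀ i → e i ≡ geom pʳ (suc i)
      e≡geom i = ≡.trans (≡.cong (λ k → divN (k ∸ 1) (pʳ ∸ 1)) (≡.trans (≡.cong (p ℕ.^_) (ℕₚ.*-comm (suc i) r)) (≡.sym (ℕₚ.^-*-assoc p r (suc i)))))
                         (divN-geom pʳ (suc i) 2≤pʳ)

      mn/d≡nt : divN (m ℕ.* n) d ≡ n ℕ.* t
      mn/d≡nt = ≡.trans (≡.cong (λ k → divN k d) (≡.trans (≡.cong (ℕ._* n) m≡t*d) (lemma t d n))) (divN-* (n ℕ.* t) d 1≤d)
        where
        lemma : ∀ t d n → t ℕ.* d ℕ.* n ≡ n ℕ.* t ℕ.* d
        lemma = solve-∀

      m/d≡t : divN m d ≡ t
      m/d≡t = ≡.trans (≡.cong (λ k → divN k d) m≡t*d) (divN-* t d 1≤d)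

      t*r≡s*m : t ℕ.* r ≡ s ℕ.* m
      t*r≡s*m = ≡.trans (≡.cong (t ℕ.*_) r≡s*d) (≡.trans (lemma t s d) (≡.cong (s ℕ.*_) (≡.sym m≡t*d)))
        where
        lemma : ∀ t s d → t ℕ.* (s ℕ.* d) ≡ s ℕ.* (t ℕ.* d)
        lemma = solve-∀

      σ-tr : ∀ {v} → InFq v → σ (t ℕ.* r) v ≈ v
      σ-tr {v} v∈Fq = trans (reflexive (≡.cong (λ k → σ k v) t*r≡s*m)) (σ-*m v∈Fq s)

      σ-ntr : ∀ v → σ (n ℕ.* t ℕ.* r) v ≈ v
      σ-ntr v = trans (reflexive (≡.cong (λ k → σ k v) (≡.trans (ℕₚ.*-assoc n t r) (≡.trans (≡.cong (n ℕ.*_) t*r≡s*m) (lemma n s m))))) (σ-*mn s v)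
        where
        lemma : ∀ n s m → n ℕ.* (s ℕ.* m) ≡ s ℕ.* (m ℕ.* n)
        lemma = solve-∀

      -- Since gcd(s, t) = 1, the exponents s·i (mod t) run through the conjugates σ_{d i} of c ∈ F_q.
      module Norm (c : Carrier) (c∈Fq : InFq c) where
        private
          conj : ℕ → Carrier
          conj j = σ (d ℕ.* j) c

          conj-+t* : ∀ k j → conj (k ℕ.* t ℕ.+ j) ≈ conj j
          conj-+t* k j = trans (reflexive (≡.cong (λ z → σ z c) (≡.trans (lemma d k t j) (≡.cong (λ z → k ℕ.* z ℕ.+ d ℕ.* j) (≡.sym m≡t*d)))))
                               (σ-*m+ c∈Fq k (d ℕ.* j))
            where
            lemma : ∀ d k t j → d ℕ.* (k ℕ.* t ℕ.+ j) ≡ k ℕ.* (t ℕ.* d) ℕ.+ d ℕ.* j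
            lemma = solve-∀

          conj-%t : ∀ j → conj j ≈ conj (j % t)
          conj-%t j = trans (reflexive (≡.cong conj j≡)) (conj-+t* (j / t) (j % t))
            where
            j≡ : j ≡ j / t ℕ.* t ℕ.+ j % t
            j≡ = ≡.trans (m≡m%n+[m/n]*n j t) (ℕₚ.+-comm (j % t) _)

          Nrm≈∏conj : Nrm c ≈ Mul.big t conj
          Nrm≈∏conj = trans (reflexive (Nrm≡pow-geom c)) (trans (pow-geom c pᵈ t)
                        (Mul.big-cong t (λ i _ → reflexive (≡.cong (pow c) (ℕₚ.^-*-assoc p d i)))))

          pow-geom-pʳ : ∀ k → pow c (geom pʳ k) ≈ Mul.big k (λ i → conj (s ℕ.* i))
          pow-geom-pʳ k = trans (pow-geom c pʳ k) (Mul.big-cong k (λ i _ → trans (pow-pʳ^ c i)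
                            (reflexive (≡.cong (λ z → σ z c) (≡.trans (≡.cong (i ℕ.*_) r≡s*d) (lemma i s d))))))
            where
            lemma : ∀ i s d → i ℕ.* (s ℕ.* d) ≡ d ℕ.* (s ℕ.* i)
            lemma = solve-∀

        pow-geom-t≈Nrm : pow c (geom pʳ t) ≈ Nrm c
        pow-geom-t≈Nrm = begin
          pow c (geom pʳ t)                         ≈⟨ pow-geom-pʳ t ⟩
          Mul.big t (λ i → conj (s ℕ.* i))          ≈⟨ Mul.big-cong t (λ i _ → conj-%t (s ℕ.* i)) ⟩
          Mul.big t (λ i → conj ((s ℕ.* i) % t))    ≈⟨ Mul.big-reindex-*-mod t s coprime[s,t] conj ⟩
          Mul.big t conj                            ≈⟨ sym Nrm≈∏conj ⟩
          Nrm c                                     ∎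

        pow-geom-nt≈Nrm^n : pow c (geom pʳ (n ℕ.* t)) ≈ pow (Nrm c) n
        pow-geom-nt≈Nrm^n = begin
          pow c (geom pʳ (n ℕ.* t))                                 ≈⟨ pow-geom-pʳ (n ℕ.* t) ⟩
          Mul.big (n ℕ.* t) (λ i → conj (s ℕ.* i))                  ≈⟨ Mul.big-periodic t n _ periodic ⟩
          Mul.big n (λ _ → Mul.big t (λ i → conj (s ℕ.* i)))        ≈⟨ Mul-big-const n _ ⟩
          pow (Mul.big t (λ i → conj (s ℕ.* i))) n                  ≈⟨ pow-cong n (trans (sym (pow-geom-pʳ t)) pow-geom-t≈Nrm) ⟩
          pow (Nrm c) n                                             ∎
          where
          periodic : ∀ j → conj (s ℕ.* (t ℕ.+ j)) ≈ conj (s ℕ.* j)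
          periodic j = trans (reflexive (≡.cong conj (ℕₚ.*-distribˡ-+ s t j))) (conj-+t* s (s ℕ.* j))

        Nrm^[pᵈ-1]≈1 : ¬ (c ≈ 0#) → pow (Nrm c) (pᵈ ∸ 1) ≈ 1#
        Nrm^[pᵈ-1]≈1 c≉0 = *-cancelˡ c _ _ c≉0 (begin
          c * pow (Nrm c) (pᵈ ∸ 1)                 ≈⟨ *-congˡ (trans (pow-cong (pᵈ ∸ 1) (reflexive (Nrm≡pow-geom c))) (sym (pow-* c (geom pᵈ t) (pᵈ ∸ 1)))) ⟩
          c * pow c (geom pᵈ t ℕ.* (pᵈ ∸ 1))       ≡⟨ ≡.cong (pow c) 1+geom*[pᵈ-1]≡q ⟩
          pow c q                                  ≈⟨ c∈Fq ⟩
          c                                        ≈⟨ sym (*-identityʳ c) ⟩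
          c * 1#                                   ∎)
          where
          1+geom*[pᵈ-1]≡q : suc (geom pᵈ t ℕ.* (pᵈ ∸ 1)) ≡ q
          1+geom*[pᵈ-1]≡q = ≡.trans (≡.cong suc (ℕₚ.*-comm (geom pᵈ t) (pᵈ ∸ 1)))
            (≡.trans (ℕₚ.+-comm 1 _) (≡.trans (pred*geom+1≡^ pᵈ t (ℕₚ.≤-trans (s≤s z≤n) (2≤^ p d 2≤p 1≤d))) (≡.sym q≡pᵈ^t)))

        -- Nrm c lies in F_{p^d}^*, whose order p^d - 1 is prime to n.
        Nrm^n≈1⇒Nrm≈1 : ¬ (c ≈ 0#) → pow (Nrm c) n ≈ 1# → Nrm c ≈ 1#
        Nrm^n≈1⇒Nrm≈1 c≉0 Nrm^n≈1 with coprime-Bézout (gcd≡1⇒coprime gcd[n,pᵈ-1]≡1)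
        ... | Bézout.+- x y eq = begin
          Nrm c                                ≈⟨ sym (*-identityʳ _) ⟩
          Nrm c * 1#                           ≈⟨ *-congˡ (sym (pow-*≈1 (pᵈ ∸ 1) y (Nrm^[pᵈ-1]≈1 c≉0))) ⟩
          pow (Nrm c) (1 ℕ.+ y ℕ.* (pᵈ ∸ 1))   ≡⟨ ≡.cong (pow (Nrm c)) eq ⟩
          pow (Nrm c) (x ℕ.* n)                ≈⟨ pow-*≈1 n x Nrm^n≈1 ⟩
          1#                                   ∎
        ... | Bézout.-+ x y eq = begin
          Nrm c                                ≈⟨ sym (*-identityʳ _) ⟩
          Nrm c * 1#                           ≈⟨ *-congˡ (sym (pow-*≈1 n x Nrm^n≈1)) ⟩
          pow (Nrm c) (1 ℕ.+ x ℕ.* n)          ≡⟨ ≡.cong (pow (Nrm c)) eq ⟩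
          pow (Nrm c) (y ℕ.* (pᵈ ∸ 1))         ≈⟨ pow-*≈1 (pᵈ ∸ 1) y (Nrm^[pᵈ-1]≈1 c≉0) ⟩
          1#                                   ∎

      module Fibre (finv : Poly) (finv∈Fq : All InFq finv) (fbar∘finv : ∀ y → InFq y → fbar (eval finv y) ≈ y) (x : Carrier) where
        open WithInv finv

        z : Carrier
        z = eval finv (T x)

        z∈Fq : InFq z
        z∈Fq = Fq-eval finv∈Fq (Fq-T x)

        fbar-z : fbar z ≈ T x
        fbar-z = fbar∘finv (T x) (Fq-T x)

        C∈Fq : InFq (C x)
        C∈Fq = Fq-- (Fq-pow (pʳ ∸ 1) z∈Fq) (Fq-* a⁻¹∈Fq (Fq-eval G∈Fq z∈Fq))

        b : Carrier
        b = inv a * x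

        K-z : K z ≈ - (a * C x)
        K-z = begin
          eval G z - a * pow z (pʳ ∸ 1)                 ≈⟨ +-comm _ _ ⟩
          - (a * pow z (pʳ ∸ 1)) + eval G z             ≈⟨ +-congˡ (sym (trans (-‿involutive _) (inv-cancelʳ a _ a≉0))) ⟩
          - (a * pow z (pʳ ∸ 1)) + - - (a * (inv a * eval G z)) ≈⟨ -x+-y≈-[x+y] _ _ ⟩
          - (a * pow z (pʳ ∸ 1) + - (a * (inv a * eval G z)))  ≈⟨ -‿cong (+-congˡ (-‿distribʳ-* a _)) ⟩
          - (a * pow z (pʳ ∸ 1) + a * - (inv a * eval G z))    ≈⟨ -‿cong (sym (distribˡ a _ _)) ⟩
          - (a * C x)                                   ∎

        f-fibre : ∀ y → T y ≈ z → f y ≈ a * (σ r y - C x * y)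
        f-fibre y Ty≈z = begin
          f y                                 ≈⟨ φ-cong Ty≈z refl ⟩
          a * σ r y + y * K z                 ≈⟨ +-congˡ (trans (*-congˡ K-z) (sym (-‿distribʳ-* y _))) ⟩
          a * σ r y - y * (a * C x)           ≈⟨ +-congˡ (-‿cong (trans (x*yz≈y*xz y a _) (*-congˡ (*-comm y _)))) ⟩
          a * σ r y - a * (C x * y)           ≈⟨ +-congˡ (-‿distribʳ-* a _) ⟩
          a * σ r y + a * - (C x * y)         ≈⟨ sym (distribˡ a _ _) ⟩
          a * (σ r y - C x * y)               ∎

        f≈x : ∀ y → T y ≈ z → σ r y ≈ C x * y + b → f y ≈ x
        f≈x y Ty≈z σy≈ = begin
          f y                                 ≈⟨ f-fibre y Ty≈z ⟩
          a * (σ r y - C x * y)               ≈⟨ *-congˡ (+-congʳ σy≈) ⟩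
          a * ((C x * y + b) - C x * y)       ≈⟨ *-congˡ ([x+y]-x≈y _ _) ⟩
          a * b                               ≈⟨ inv-cancelʳ a x a≉0 ⟩
          x                                   ∎

        w : Carrier
        w = proj₁ (f-surjective x)

        f-w : f w ≈ x
        f-w = proj₂ (f-surjective x)

        T-w : T w ≈ z
        T-w = fbar-injective (T w) z (Fq-T w) z∈Fq (trans (sym (T-f w)) (trans (T-cong f-w) (sym fbar-z)))

        σ-w : σ r w ≈ C x * w + b
        σ-w = begin
          σ r w                                   ≈⟨ sym ([x-y]+y≈x _ _) ⟩
          (σ r w - C x * w) + C x * w             ≈⟨ +-comm _ _ ⟩
          C x * w + (σ r w - C x * w)             ≈⟨ +-congˡ (sym (inv-cancelˡ a _ a≉0)) ⟩
          C x * w + inv a * (a * (σ r w - C x * w)) ≈⟨ +-congˡ (*-congˡ (trans (sym (f-fibre w T-w)) f-w)) ⟩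
          C x * w + b                             ∎

        f-via-w : ∀ y → w ≈ y → f y ≈ x
        f-via-w y w≈y = trans (f-cong (sym w≈y)) f-w

        preimage₁ : C x ≈ 0# → f (formula1 x) ≈ x
        preimage₁ C≈0 = f-via-w (formula1 x) (begin
          w                                    ≈⟨ sym (σ-*mn r w) ⟩
          σ (r ℕ.* (m ℕ.* n)) w                ≡⟨ ≡.cong (λ k → σ k w) (≡.trans (ℕₚ.*-comm r (m ℕ.* n)) (≡.sym (ℕₚ.m+[n∸m]≡n r≤mnr))) ⟩
          σ (r ℕ.+ (m ℕ.* n ℕ.* r ∸ r)) w      ≈⟨ sym (σ-∘ (m ℕ.* n ℕ.* r ∸ r) r w) ⟩
          σ (m ℕ.* n ℕ.* r ∸ r) (σ r w)        ≈⟨ σ-cong (m ℕ.* n ℕ.* r ∸ r) (trans σ-w (trans (+-congʳ (trans (*-congʳ C≈0) (zeroˡ w))) (+-identityˡ b))) ⟩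
          σ (m ℕ.* n ℕ.* r ∸ r) b              ≈⟨ σ-cong (m ℕ.* n ℕ.* r ∸ r) (*-comm _ _) ⟩
          formula1 x                           ∎)
          where
          r≤mnr : r ≤ m ℕ.* n ℕ.* r
          r≤mnr = ≡.subst (_≤ m ℕ.* n ℕ.* r) (ℕₚ.*-identityˡ r) (ℕₚ.*-monoˡ-≤ r 1≤mn)

        σ-z : σ r z ≈ C x * z + T b
        σ-z = sym (begin
          C x * z + T b                                                ≈⟨ +-cong (distribʳ z _ _) (T-*ˡ x a⁻¹∈Fq) ⟩
          (pow z (pʳ ∸ 1) * z + - (inv a * eval G z) * z) + inv a * T x ≈⟨ +-congʳ (+-cong (trans (*-comm _ _) (sym (pow-pʳ z))) (sym (-‿distribˡ-* _ z))) ⟩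
          (σ r z - (inv a * eval G z) * z) + inv a * T x               ≈⟨ +-congʳ (+-congˡ (-‿cong (trans (*-assoc _ _ _) (*-congˡ (trans (*-comm _ _) fbar-z))))) ⟩
          (σ r z - inv a * T x) + inv a * T x                          ≈⟨ [x-y]+y≈x _ _ ⟩
          σ r z                                                        ∎)

        private
          instance
            n≢0 : NonZero n
            n≢0 = ℕ.>-nonZero 1≤n

          n≡1+[n-1] : n ≡ suc (n ∸ 1)
          n≡1+[n-1] = ≡.sym (ℕₚ.m+[n∸m]≡n {1} {n} 1≤n)

          Y : ℕ → Carrier
          Y j = σ (j ℕ.* s ℕ.* m) x

          σ-Y : ∀ j → σ (s ℕ.* m) (Y j) ≈ Y (suc j)
          σ-Y j = trans (σ-∘ (s ℕ.* m) (j ℕ.* s ℕ.* m) x) (reflexive (≡.cong (λ k → σ k x) (lemma j s m)))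
            where
            lemma : ∀ j s m → j ℕ.* s ℕ.* m ℕ.+ s ℕ.* m ≡ suc j ℕ.* s ℕ.* m
            lemma = solve-∀

          Y-n : Y n ≈ x
          Y-n = trans (reflexive (≡.cong (λ k → σ k x) (lemma n s m))) (σ-*mn s x)
            where
            lemma : ∀ n s m → n ℕ.* s ℕ.* m ≡ s ℕ.* (m ℕ.* n)
            lemma = solve-∀

          T-Y : ∀ j → T (Y j) ≈ T x
          T-Y j = trans (T-σ (j ℕ.* s ℕ.* m) x) (σ-*m (Fq-T x) (j ℕ.* s))

          S≈ΣY : S x ≈ Σ< (n ∸ 1) (λ j → suc j · Y (suc j))
          S≈ΣY = Σ<-cong (n ∸ 1) (λ j _ → ·-cong (suc j) (reflexive (≡.cong (λ k → pow x (p ℕ.^ k))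
            (≡.trans (≡.cong (λ k → divN k d) (≡.trans (≡.cong (suc j ℕ.* m ℕ.*_) r≡s*d) (lemma (suc j) m s d))) (divN-* (suc j ℕ.* s ℕ.* m) d 1≤d)))))
            where
            lemma : ∀ J m s d → J ℕ.* m ℕ.* (s ℕ.* d) ≡ J ℕ.* s ℕ.* m ℕ.* d
            lemma = solve-∀

          -- Since gcd(s, n) = 1, the conjugates σ_{jsm}(x), j < n, are those of the trace in another order.
          T≈ΣY : T x ≈ Σ< n Y
          T≈ΣY = begin
            T x                                  ≈⟨ Σ<-cong n (λ i _ → pow-q^ x i) ⟩
            Σ< n g                               ≡⟨ Σ<≡big n g ⟩
            Add.big n g                          ≈⟨ sym (Add.big-reindex-*-mod n s coprime[s,n] g) ⟩
            Add.big n (λ j → g ((s ℕ.* j) % n))  ≡⟨ ≡.sym (Σ<≡big n _) ⟩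
            Σ< n (λ j → g ((s ℕ.* j) % n))       ≈⟨ Σ<-cong n (λ j _ → trans (sym (g-%n (s ℕ.* j))) (reflexive (≡.cong (λ k → σ (k ℕ.* m) x) (ℕₚ.*-comm s j)))) ⟩
            Σ< n Y                               ∎
            where
            g : ℕ → Carrier
            g i = σ (i ℕ.* m) x
            g-%n : ∀ j → g j ≈ g (j % n)
            g-%n j = trans (reflexive (≡.cong (λ k → σ k x) j*m≡))
                           (trans (sym (σ-∘ ((j % n) ℕ.* m) (j / n ℕ.* (m ℕ.* n)) x)) (σ-cong ((j % n) ℕ.* m) (σ-*mn (j / n) x)))
              where
              lemma : ∀ a k n m → (a ℕ.+ k ℕ.* n) ℕ.* m ≡ k ℕ.* (m ℕ.* n) ℕ.+ a ℕ.* m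
              lemma = solve-∀
              j*m≡ : j ℕ.* m ≡ j / n ℕ.* (m ℕ.* n) ℕ.+ (j % n) ℕ.* m
              j*m≡ = ≡.trans (≡.cong (ℕ._* m) (m≡m%n+[m/n]*n j n)) (lemma (j % n) (j / n) n m)

        -- Summation by parts: σ_{sm} shifts the weights of S x by one, and T x supplies the missing terms.
        σ-sm-S : σ (s ℕ.* m) (S x) + T x ≈ S x + n · x
        σ-sm-S = begin
          σ (s ℕ.* m) (S x) + T x                                            ≈⟨ +-cong (σ-cong (s ℕ.* m) S≈ΣY) T≈ΣY ⟩
          σ (s ℕ.* m) (Σ< (n ∸ 1) (λ j → suc j · Y (suc j))) + Σ< n Y          ≈⟨ +-cong σ-sum (sym (Σ<-rotate n Y (trans Y-n (sym (σ-zero x))))) ⟩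
          Σ< (n ∸ 1) (λ j → suc j · Y (suc (suc j))) + Σ< n (λ j → Y (suc j))  ≡⟨ ≡.cong (λ k → Σ< (n ∸ 1) (λ j → suc j · Y (suc (suc j))) + Σ< k (λ j → Y (suc j))) n≡1+[n-1] ⟩
          Σ< (n ∸ 1) (λ j → suc j · Y (suc (suc j))) + Σ< (suc (n ∸ 1)) (λ j → Y (suc j)) ≈⟨ Σ<-weighted-shift (n ∸ 1) (λ j → Y (suc j)) ⟩
          Σ< (n ∸ 1) (λ j → suc j · Y (suc j)) + suc (n ∸ 1) · Y (suc (n ∸ 1)) ≡⟨ ≡.cong (λ k → Σ< (n ∸ 1) (λ j → suc j · Y (suc j)) + k · Y k) (≡.sym n≡1+[n-1]) ⟩
          Σ< (n ∸ 1) (λ j → suc j · Y (suc j)) + n · Y n                      ≈⟨ +-cong (sym S≈ΣY) (·-cong n Y-n) ⟩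
          S x + n · x                                                        ∎
          where
          σ-sum : σ (s ℕ.* m) (Σ< (n ∸ 1) (λ j → suc j · Y (suc j))) ≈ Σ< (n ∸ 1) (λ j → suc j · Y (suc (suc j)))
          σ-sum = trans (σ-Σ< (s ℕ.* m) (n ∸ 1) _) (Σ<-cong (n ∸ 1) (λ j _ → trans (σ-· (s ℕ.* m) (suc j) _) (·-cong (suc j) (σ-Y (suc j)))))

        T-S : T (S x) ≈ Σ< (n ∸ 1) (λ j → suc j · T x)
        T-S = trans (T-cong S≈ΣY) (trans (T-Σ< (n ∸ 1) _) (Σ<-cong (n ∸ 1) (λ j _ → trans (T-· (suc j) _) (·-cong (suc j) (T-Y (suc j))))))

        module _ (C≉0 : ¬ (C x ≈ 0#)) where
          D : Carrier
          D = inv (C x)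

          D∈Fq : InFq D
          D∈Fq = Fq-inv C≉0 C∈Fq

          D*C≈1 : D * C x ≈ 1#
          D*C≈1 = inv*x≈1 (C x) C≉0

          D^e : ∀ i → pow (inv (C x)) (e i) ≡ pow D (geom pʳ (suc i))
          D^e i = ≡.cong (pow D) (e≡geom i)

          -- Telescoping over a full period σ_{mnr} = id: (Nrm C)^(-n) w = w + S₂, solved for w.
          preimage₂ : ¬ (Nrm (C x) ≈ 1#) → ¬ (pow (Nrm (C x)) n ≈ 1#) × f (formula2 x) ≈ x
          preimage₂ Nrm≉1 = M≉1 , f-via-w (formula2 x) (begin
            w                                  ≈⟨ sym (inv-cancelˡ (1# - M) w 1-M≉0) ⟩
            inv (1# - M) * ((1# - M) * w)      ≈⟨ *-congˡ [1-M]w≈M*S₂ ⟩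
            inv (1# - M) * (M * S₂)            ≈⟨ trans (sym (*-assoc _ _ _)) (*-congʳ (*-comm _ _)) ⟩
            (M * inv (1# - M)) * S₂            ∎)
            where
            open Norm (C x) C∈Fq
            M = pow (Nrm (C x)) n
            M≉1 : ¬ (M ≈ 1#)
            M≉1 M≈1 = Nrm≉1 (Nrm^n≈1⇒Nrm≈1 C≉0 M≈1)
            M≉0 : ¬ (M ≈ 0#)
            M≉0 = pow-≉0 (Nrm (C x)) n (pow-≉0 (C x) (divN (q ∸ 1) (p ℕ.^ d ∸ 1)) C≉0)
            1-M≉0 : ¬ (1# - M ≈ 0#)
            1-M≉0 1-M≈0 = M≉1 (sym (x-y≈0⇒x≈y 1# M 1-M≈0))
            K′ = divN (m ℕ.* n) d
            S₂ = Σ< K′ (λ i → pow (inv (C x)) (e i) * pow (inv a * x) (p ℕ.^ (i ℕ.* r)))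
            D^geom≈M⁻¹ : pow D (geom pʳ K′) ≈ inv M
            D^geom≈M⁻¹ = trans (pow-inv (C x) (geom pʳ K′) C≉0) (inv-cong (pow-≉0 (C x) (geom pʳ K′) C≉0)
              (trans (reflexive (≡.cong (λ k → pow (C x) (geom pʳ k)) mn/d≡nt)) pow-geom-nt≈Nrm^n))
            M⁻¹w≈w+S₂ : inv M * w ≈ w + S₂
            M⁻¹w≈w+S₂ = begin
              inv M * w                                  ≈⟨ *-cong (sym D^geom≈M⁻¹) (sym (trans (reflexive (≡.cong (λ k → σ (k ℕ.* r) w) mn/d≡nt)) (σ-ntr w))) ⟩
              pow D (geom pʳ K′) * σ (K′ ℕ.* r) w        ≈⟨ telescope (C x) w b C≉0 σ-w K′ ⟩
              w + Σ< K′ (λ i → pow D (geom pʳ (suc i)) * σ (i ℕ.* r) b) ≈⟨ +-congˡ (Σ<-cong K′ (λ i _ → reflexive (≡.cong (_* σ (i ℕ.* r) b) (≡.sym (D^e i))))) ⟩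
              w + S₂                                     ∎
            [1-M]w≈M*S₂ : (1# - M) * w ≈ M * S₂
            [1-M]w≈M*S₂ = begin
              (1# - M) * w                        ≈⟨ trans (distribʳ w 1# (- M)) (+-cong (*-identityˡ w) (sym (-‿distribˡ-* M w))) ⟩
              w - M * w                           ≈⟨ +-congʳ (trans (sym (inv-cancelʳ M w M≉0)) (trans (*-congˡ M⁻¹w≈w+S₂) (distribˡ M w S₂))) ⟩
              (M * w + M * S₂) - M * w            ≈⟨ [x+y]-x≈y _ _ ⟩
              M * S₂                              ∎

          module _ (Nrm≈1 : Nrm (C x) ≈ 1#) where
            D^geom-t≈1 : pow D (geom pʳ t) ≈ 1#
            D^geom-t≈1 = trans (pow-inv (C x) (geom pʳ t) C≉0)
              (trans (inv-cong (pow-≉0 (C x) (geom pʳ t) C≉0) (trans (Norm.pow-geom-t≈Nrm (C x) C∈Fq) Nrm≈1)) inv-1#)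

            L : Carrier → Carrier
            L v = Σ< t (λ j → pow D (geom pʳ (suc j)) * σ (j ℕ.* r) v)

            L-cong : ∀ {v v′} → v ≈ v′ → L v ≈ L v′
            L-cong v≈v′ = Σ<-cong t (λ j _ → *-congˡ (σ-cong (j ℕ.* r) v≈v′))

            L-+ : ∀ v v′ → L (v + v′) ≈ L v + L v′
            L-+ v v′ = trans (Σ<-cong t (λ j _ → trans (*-congˡ (σ-+ (j ℕ.* r) v v′)) (distribˡ _ _ _))) (Σ<-+ t _ _)

            L-0# : L 0# ≈ 0#
            L-0# = trans (Σ<-cong t (λ j _ → trans (*-congˡ (σ-0# (j ℕ.* r))) (zeroʳ _))) (Σ<-0# t)

            L-· : ∀ k v → L (k · v) ≈ k · L v
            L-· zero v = L-0#
            L-· (suc k) v = trans (L-+ v (k · v)) (+-congˡ (L-· k v))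

            L-Σ< : ∀ k g → L (Σ< k g) ≈ Σ< k (λ j → L (g j))
            L-Σ< zero g = L-0#
            L-Σ< (suc k) g = trans (L-+ _ _) (+-congʳ (L-Σ< k g))

            T-L : ∀ v → T (L v) ≈ L (T v)
            T-L v = trans (T-Σ< t _) (Σ<-cong t (λ j _ → trans (T-*ˡ _ (Fq-pow (geom pʳ (suc j)) D∈Fq)) (*-congˡ (T-σ (j ℕ.* r) v))))

            L-Tb≈0 : L (T b) ≈ 0#
            L-Tb≈0 = +-cancelʳ z _ _ (trans (+-comm _ _) (begin
              z + L (T b)                           ≈⟨ sym (telescope (C x) z (T b) C≉0 σ-z t) ⟩
              pow D (geom pʳ t) * σ (t ℕ.* r) z      ≈⟨ *-cong D^geom-t≈1 (σ-tr z∈Fq) ⟩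
              1# * z                                ≈⟨ trans (*-identityˡ z) (sym (+-identityˡ z)) ⟩
              0# + z                                ∎))

            C*D^geom-suc : ∀ k → C x * pow D (geom pʳ (suc k)) ≈ pow D (pʳ ℕ.* geom pʳ k)
            C*D^geom-suc k = trans (sym (*-assoc _ _ _)) (trans (*-congʳ (trans (*-comm _ _) D*C≈1)) (*-identityˡ _))

            module _ (v : Carrier) where
              private
                h : ℕ → Carrier
                h k = pow D (geom pʳ (suc k)) * σ (k ℕ.* r) v

                σ-h : ∀ k → σ r (h k) ≈ C x * h (suc k)
                σ-h k = begin
                  σ r (pow D (geom pʳ (suc k)) * σ (k ℕ.* r) v)          ≈⟨ σ-* r _ _ ⟩
                  σ r (pow D (geom pʳ (suc k))) * σ r (σ (k ℕ.* r) v)     ≈⟨ *-cong (pow-comm D (geom pʳ (suc k)) pʳ) (σ-∘ r (k ℕ.* r) v) ⟩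
                  pow (pow D pʳ) (geom pʳ (suc k)) * σ (k ℕ.* r ℕ.+ r) v  ≈⟨ *-cong (sym (pow-* D pʳ _)) (reflexive (≡.cong (λ j → σ j v) (ℕₚ.+-comm (k ℕ.* r) r))) ⟩
                  pow D (pʳ ℕ.* geom pʳ (suc k)) * σ (suc k ℕ.* r) v      ≈⟨ *-congʳ (sym (C*D^geom-suc (suc k))) ⟩
                  (C x * pow D (geom pʳ (suc (suc k)))) * σ (suc k ℕ.* r) v ≈⟨ *-assoc _ _ _ ⟩
                  C x * h (suc k)                                        ∎

                C*h-0 : C x * h 0 ≈ v
                C*h-0 = begin
                  C x * (pow D (geom pʳ 1) * σ 0 v)               ≈⟨ trans (sym (*-assoc _ _ _)) (*-congʳ (C*D^geom-suc 0)) ⟩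
                  pow D (pʳ ℕ.* 0) * σ 0 v                        ≈⟨ *-cong (reflexive (≡.cong (pow D) (ℕₚ.*-zeroʳ pʳ))) (σ-zero v) ⟩
                  1# * v                                          ≈⟨ *-identityˡ v ⟩
                  v                                               ∎

                σ-Σh : ∀ k → σ r (Σ< k h) + v ≈ C x * Σ< k h + C x * h k
                σ-Σh zero = begin
                  σ r 0# + v                                       ≈⟨ trans (+-congʳ (σ-0# r)) (+-identityˡ v) ⟩
                  v                                                ≈⟨ sym C*h-0 ⟩
                  C x * h 0                                        ≈⟨ sym (trans (+-congʳ (zeroʳ (C x))) (+-identityˡ _)) ⟩
                  C x * 0# + C x * h 0                             ∎
                σ-Σh (suc k) = begin
                  σ r (Σ< k h + h k) + v                           ≈⟨ trans (+-congʳ (σ-+ r _ _)) (xy+z≈xz+y _ _ _) ⟩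
                  (σ r (Σ< k h) + v) + σ r (h k)                   ≈⟨ +-cong (σ-Σh k) (σ-h k) ⟩
                  (C x * Σ< k h + C x * h k) + C x * h (suc k)      ≈⟨ +-congʳ (sym (distribˡ (C x) _ _)) ⟩
                  C x * Σ< (suc k) h + C x * h (suc k)             ∎

                C*h-t : C x * h t ≈ σ (t ℕ.* r) v
                C*h-t = begin
                  C x * (pow D (geom pʳ (suc t)) * σ (t ℕ.* r) v)   ≈⟨ trans (sym (*-assoc _ _ _)) (*-congʳ (C*D^geom-suc t)) ⟩
                  pow D (pʳ ℕ.* geom pʳ t) * σ (t ℕ.* r) v          ≈⟨ *-congʳ (pow-*≈1 (geom pʳ t) pʳ D^geom-t≈1) ⟩
                  1# * σ (t ℕ.* r) v                                ≈⟨ *-identityˡ _ ⟩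
                  σ (t ℕ.* r) v                                     ∎

              σ-L : σ r (L v) + v ≈ C x * L v + σ (t ℕ.* r) v
              σ-L = trans (σ-Σh t) (+-congˡ C*h-t)

            Sₐ : Carrier
            Sₐ = inv a * S x

            W : Carrier
            W = Σ< (divN m d) (λ j → pow (inv (C x)) (e j) * pow (inv a * S x) (p ℕ.^ (j ℕ.* r)))

            W≈L-Sₐ : W ≈ L Sₐ
            W≈L-Sₐ = trans (reflexive (≡.cong (λ k → Σ< k (λ j → pow (inv (C x)) (e j) * pow Sₐ (p ℕ.^ (j ℕ.* r)))) m/d≡t))
                           (Σ<-cong t (λ j _ → reflexive (≡.cong (_* σ (j ℕ.* r) Sₐ) (D^e j))))

            T-W : T W ≈ 0#
            T-W = begin
              T W                                     ≈⟨ trans (T-cong W≈L-Sₐ) (T-L Sₐ) ⟩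
              L (T Sₐ)                                ≈⟨ L-cong (trans (T-*ˡ (S x) a⁻¹∈Fq) (trans (*-congˡ T-S) (*-Σ< (n ∸ 1) _ _))) ⟩
              L (Σ< (n ∸ 1) (λ j → inv a * (suc j · T x))) ≈⟨ L-Σ< (n ∸ 1) _ ⟩
              Σ< (n ∸ 1) (λ j → L (inv a * (suc j · T x))) ≈⟨ Σ<-cong (n ∸ 1) (λ j _ → L-j·Tb j) ⟩
              Σ< (n ∸ 1) (λ _ → 0#)                   ≈⟨ Σ<-0# (n ∸ 1) ⟩
              0#                                      ∎
              where
              L-j·Tb : ∀ j → L (inv a * (suc j · T x)) ≈ 0#
              L-j·Tb j = begin
                L (inv a * (suc j · T x))   ≈⟨ L-cong (trans (sym (·-comm-* (suc j) (inv a) (T x))) (·-cong (suc j) (sym (T-*ˡ x a⁻¹∈Fq)))) ⟩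
                L (suc j · T b)             ≈⟨ trans (L-· (suc j) (T b)) (·-cong (suc j) L-Tb≈0) ⟩
                suc j · 0#                  ≈⟨ ·-0# (suc j) ⟩
                0#                          ∎

            σ-tr-Sₐ : σ (t ℕ.* r) Sₐ + T b ≈ Sₐ + n · b
            σ-tr-Sₐ = begin
              σ (t ℕ.* r) Sₐ + T b                         ≈⟨ +-cong (trans (σ-* (t ℕ.* r) _ _) (*-cong (σ-tr a⁻¹∈Fq) (reflexive (≡.cong (λ k → σ k (S x)) t*r≡s*m)))) (T-*ˡ x a⁻¹∈Fq) ⟩
              inv a * σ (s ℕ.* m) (S x) + inv a * T x      ≈⟨ sym (distribˡ _ _ _) ⟩
              inv a * (σ (s ℕ.* m) (S x) + T x)            ≈⟨ *-congˡ σ-sm-S ⟩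
              inv a * (S x + n · x)                        ≈⟨ distribˡ _ _ _ ⟩
              Sₐ + inv a * (n · x)                         ≈⟨ +-congˡ (sym (·-comm-* n (inv a) x)) ⟩
              Sₐ + n · b                                   ∎

            σ-[z+W] : σ r (z + W) ≈ C x * (z + W) + n · b
            σ-[z+W] = begin
              σ r (z + W)                       ≈⟨ trans (σ-+ r z W) (+-congʳ σ-z) ⟩
              (C x * z + T b) + σ r W           ≈⟨ trans (+-assoc _ _ _) (+-congˡ (+-comm _ _)) ⟩
              C x * z + (σ r W + T b)           ≈⟨ +-congˡ σ-W ⟩
              C x * z + (C x * W + n · b)       ≈⟨ trans (sym (+-assoc _ _ _)) (+-congʳ (sym (distribˡ (C x) z W))) ⟩
              C x * (z + W) + n · b             ∎
              where
              σ-W : σ r W + T b ≈ C x * W + n · b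
              σ-W = +-cancelʳ Sₐ _ _ (begin
                (σ r W + T b) + Sₐ                ≈⟨ xy+z≈xz+y _ _ _ ⟩
                (σ r W + Sₐ) + T b                ≈⟨ +-congʳ (trans (+-congʳ (σ-cong r W≈L-Sₐ)) (trans (σ-L Sₐ) (+-congʳ (*-congˡ (sym W≈L-Sₐ))))) ⟩
                (C x * W + σ (t ℕ.* r) Sₐ) + T b  ≈⟨ +-assoc _ _ _ ⟩
                C x * W + (σ (t ℕ.* r) Sₐ + T b)  ≈⟨ +-congˡ (trans σ-tr-Sₐ (+-comm _ _)) ⟩
                C x * W + (n · b + Sₐ)            ≈⟨ sym (+-assoc _ _ _) ⟩
                (C x * W + n · b) + Sₐ            ∎)

            -- formula3 x = (z + W)/n, with T W = 0 and σ_r(z + W) = C (z + W) + n b.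
            preimage₃ : f (formula3 x) ≈ x
            preimage₃ = f≈x (formula3 x) T-formula3 σ-formula3
              where
              T-formula3 : T (1/n * (z + W)) ≈ z
              T-formula3 = begin
                T (1/n * (z + W))            ≈⟨ T-*ˡ _ (σ-1/n m) ⟩
                1/n * T (z + W)              ≈⟨ *-congˡ (trans (T-+ z W) (+-cong (T-Fq z∈Fq) T-W)) ⟩
                1/n * (n · z + 0#)           ≈⟨ trans (*-congˡ (+-identityʳ _)) (1/n*[n·] z) ⟩
                z                            ∎
              σ-formula3 : σ r (1/n * (z + W)) ≈ C x * (1/n * (z + W)) + b
              σ-formula3 = begin
                σ r (1/n * (z + W))                  ≈⟨ trans (σ-* r 1/n _) (*-congʳ (σ-1/n r)) ⟩
                1/n * σ r (z + W)                    ≈⟨ *-congˡ σ-[z+W] ⟩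
                1/n * (C x * (z + W) + n · b)        ≈⟨ distribˡ _ _ _ ⟩
                1/n * (C x * (z + W)) + 1/n * (n · b) ≈⟨ +-cong (x*yz≈y*xz 1/n (C x) _) (1/n*[n·] b) ⟩
                C x * (1/n * (z + W)) + b            ∎

theorem4p2 :
  (R : CommutativeRing 0ℓ 0ℓ) →
  (inv : CommutativeRing.Carrier R → CommutativeRing.Carrier R) →
  let open CommutativeRing R in
  (∀ x → ¬ (x ≈ 0#) → x * inv x ≈ 1#) →
  (p m n r : ℕ) → Prime p → m ≥ 1 → n ≥ 1 → r ≥ 1 →
  let open Setup R inv p m n r in
  HasSize (p ℕ.^ (m ℕ.* n)) →
  gcd m r ≡ gcd (m ℕ.* n) r → ¬ (p ∣ n) → gcd n (p ℕ.^ gcd m r ∸ 1) ≡ 1 →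
  (G : Poly) → All InFq G →
  (a : Carrier) → InFq a → ¬ (a ≈ 0#) →
  let open WithG G a in
  PermOn (λ _ → ⊤) f →
  PermOn InFq fbar
  × (∀ y → InFq y → PermOn (λ x → T x ≈ 0#) (φ y))
  × ((finv : Poly) → All InFq finv →
     (∀ y → InFq y → fbar (eval finv y) ≈ y) →
     let open WithInv finv in
     ∀ x →
       (C x ≈ 0# → f (formula1 x) ≈ x)
       × (¬ (C x ≈ 0#) → ¬ (Nrm (C x) ≈ 1#) →
            ¬ (pow (Nrm (C x)) n ≈ 1#) × f (formula2 x) ≈ x)
       × (¬ (C x ≈ 0#) → Nrm (C x) ≈ 1# → f (formula3 x) ≈ x))
theorem4p2 R inv x*inv≈1 p m n r pr 1≤m 1≤n 1≤r hs d≡gcd[mn,r] p∤n gcd[n,pᵈ-1]≡1 G G∈Fq a a∈Fq a≉0 f-permutation =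
  fbar-permutation , φ-permutation , λ finv finv∈Fq fbar∘finv x →
    let open Fibre finv finv∈Fq fbar∘finv x in
    preimage₁ , preimage₂ , preimage₃
  where
  open FieldOfSize R inv x*inv≈1 p m n r pr 1≤m 1≤n 1≤r hs
  open Reduction p∤n G G∈Fq a a∈Fq a≉0 f-permutation
  open Preimage d≡gcd[mn,r] gcd[n,pᵈ-1]≡1
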